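{- Endow $\mathcal{FF}$, $\mathcal{M}ould_0$ and $\mathcal{M}ould_1$ with their natural actions of the symmetric groups, making them symmetric operads $\mathcal{FF}^\Sigma$, $\mathcal{M}ould_0^\Sigma$, $\mathcal{M}ould_1^\Sigma$. Then the map $\phi^0$ (sending $[S]\mapsto\sum_{i\in S}u_i$) is an injective morphism of symmetric set-operads from $\mathcal{FF}^\Sigma$ to $\mathrm{Set}(\mathcal{M}ould_0^\Sigma)$, and the map $\phi^1$ (sending $[S]\mapsto(\prod_{i\in S}u_i)-1$) is an injective morphism of symmetric set-operads from $\mathcal{FF}^\Sigma$ to $\mathrm{Set}(\mathcal{M}ould_1^\Sigma)$.
   Context: $\mathcal{FF}(n)$ is the set of formal fractions whose numerator and denominator are products of formal symbols $[S]$, $S$ a non-empty subset of $\{1,\dots,n\}$, with cancellation of common symbols (the free abelian group, written multiplicatively, on the $[S]$). For $F\in\mathcal{FF}(m)$ and sets $I_1,\dots,I_m$, $F(I_1,\dots,I_m)$ replaces each $[S]$ by $[\bigcup_{k\in S}I_k]$. Composition: $F\circ_i G=[S_{i,n}]\,F(1,\dots,i-1,S_{i,n},i+n,\dots,m+n-1)\,G(i,\dots,i+n-1)$ for $G\in\mathcal{FF}(n)$, $S_{i,n}=\{i,\dots,i+n-1\}$. The symmetric group $S_n$ acts on $\mathcal{FF}(n)$ by $\sigma\cdot[S]=[\sigma(S)]$. $\mathcal{M}ould_0(n)=\mathcal{M}ould_1(n)=\mathbb{Q}(u_1,\dots,u_n)$ with $S_n$ acting by permuting the variables; in $\mathcal{M}ould_0$,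 $F\circ_iG=\Sigma\,F(u_1,\dots,u_{i-1},\Sigma,u_{i+n},\dots,u_{m+n-1})\,G(u_i,\dots,u_{i+n-1})$ with $\Sigma=u_i+\dots+u_{i+n-1}$; in $\mathcal{M}ould_1$, $F\circ_iG=(P-1)\,F(u_1,\dots,u_{i-1},P,u_{i+n},\dots,u_{m+n-1})\,G(u_i,\dots,u_{i+n-1})$ with $P=u_i\cdots u_{i+n-1}$. $\mathrm{Set}(\cdot)$ forgets the linear structure. -}

module Defs where

open import Data.Nat as ℕ using (ℕ; zero; suc; _≤_; _<_; s≤s)
open import Data.Nat.Properties using (≤-trans; m≤m+n; +-mono-≤; +-monoˡ-≤)
open import Data.Rational as ℚ using (ℚ; 0ℚ; 1ℚ)
open import Data.Bool using (Bool; true; false; if_then_else_)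
open import Data.Fin using (Fin; zero; suc; toℕ; fromℕ<)
open import Data.Fin.Properties using (toℕ≤pred[n])
open import Data.Fin.Subset using (Subset; ⁅_⁆; _∪_; Nonempty)
open import Data.Fin.Permutation using (Permutation′; _⟨$⟩ʳ_; _⟨$⟩ˡ_)
open import Data.Vec as Vec using (Vec)
open import Data.Vec.Properties using (≡-dec)
open import Data.List as List using (List; []; _∷_; _++_)
open import Data.List.Relation.Unary.All using (All)
open import Data.Product using (_×_; _,_; proj₁; proj₂)
open import Relation.Nullary using (¬_; yes; no; does)
open import Relation.Binary.PropositionalEquality using (_≡_)
import Data.Nat as N
import Data.Bool as B
import Data.Fin as F

-- Multivariate polynomials over ℚ in variables u_0 … u_{k-1}
-- (0-based: u_j here is the paper's u_{j+1}).

Mono : ℕ → Set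
Mono k = Vec ℕ k

Poly : ℕ → Set
Poly k = List (ℚ × Mono k)

coeff : ∀ {k} → Poly k → Mono k → ℚ
coeff [] m = 0ℚ
coeff ((c , m′) ∷ p) m with ≡-dec N._≟_ m′ m
... | yes _ = c ℚ.+ coeff p m
... | no _ = coeff p m

infix 4 _≈P_
_≈P_ : ∀ {k} → Poly k → Poly k → Set
p ≈P q = ∀ m → coeff p m ≡ coeff q m

0P : ∀ {k} → Poly k
0P = []

constP : ∀ {k} → ℚ → Poly k
constP c = (c , Vec.replicate _ 0) ∷ []

1P : ∀ {k} → Poly k
1P = constP 1ℚ

varP : ∀ {k} → Fin k → Poly k
varP j = (1ℚ , Vec.tabulate (λ l → if does (l F.≟ j) then 1 else 0)) ∷ []

infixl 6 _+P_ _-P_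
infixl 7 _*P_

_+P_ : ∀ {k} → Poly k → Poly k → Poly k
_+P_ = _++_

-P_ : ∀ {k} → Poly k → Poly k
-P p = List.map (λ t → (ℚ.- proj₁ t , proj₂ t)) p

_-P_ : ∀ {k} → Poly k → Poly k → Poly k
p -P q = p +P (-P q)

_*P_ : ∀ {k} → Poly k → Poly k → Poly k
p *P q = List.concatMap
  (λ t → List.map (λ s → (proj₁ t ℚ.* proj₁ s , Vec.zipWith N._+_ (proj₂ t) (proj₂ s))) q) p

sumP : ∀ {k} → List (Poly k) → Poly k
sumP = List.foldr _+P_ 0P

prodP : ∀ {k} → List (Poly k) → Poly k
prodP = List.foldr _*P_ 1P

powP : ∀ {k} → Poly k → ℕ → Poly k
powP p zero = 1P
powP p (suc e) = p *P powP p e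

substP : ∀ {k r} → (Fin k → Poly r) → Poly k → Poly r
substP {k} σ p = sumP (List.map
  (λ t → constP (proj₁ t) *P prodP (List.tabulate (λ j → powP (σ j) (Vec.lookup (proj₂ t) j)))) p)

-- Rational functions ℚ(u_0,…,u_{k-1}) = Mould(k): fractions num/den
-- with den ≠ 0, equal iff num·den′ = num′·den.

record RatFun (k : ℕ) : Set where
  constructor _/_
  field
    num : Poly k
    den : Poly k
open RatFun public

ValidR : ∀ {k} → RatFun k → Set
ValidR f = ¬ (den f ≈P 0P)

infix 4 _≈R_
_≈R_ : ∀ {k} → RatFun k → RatFun k → Set
f ≈R g = num f *P den g ≈P num g *P den f

infixl 7 _*R_
_*R_ : ∀ {k} → RatFun k → RatFun k → RatFun k
f *R g = (num f *P num g) / (den f *P den g)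

polyR : ∀ {k} → Poly k → RatFun k
polyR p = p / 1P

substR : ∀ {k r} → (Fin k → Poly r) → RatFun k → RatFun r
substR σ f = substP σ (num f) / substP σ (den f)

actR : ∀ {k} → Permutation′ k → RatFun k → RatFun k
actR σ f = substR (λ j → varP (σ ⟨$⟩ʳ j)) f

-- Positions for partial composition  ∘_i  : arity (suc m) , arity (suc n)
-- ↦ arity suc (m + n) = (suc m) + (suc n) - 1.  Everything 0-based.

pos : ∀ {r} (x : ℕ) → x ≤ r → Fin (suc r)
pos x x≤r = fromℕ< (s≤s x≤r)

fpos : ∀ {m n} → Fin (suc m) → Fin (suc m) → Fin (suc (m N.+ n))
fpos {m} {n} i k with toℕ k N.<? toℕ i
... | yes _ = pos (toℕ k) (≤-trans (toℕ≤pred[n] k) (m≤m+n m n))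
... | no _  = pos (toℕ k N.+ n) (+-monoˡ-≤ n (toℕ≤pred[n] k))

gpos : ∀ {m n} → Fin (suc m) → Fin (suc n) → Fin (suc (m N.+ n))
gpos i j = pos (toℕ i N.+ toℕ j) (+-mono-≤ (toℕ≤pred[n] i) (toℕ≤pred[n] j))

-- Formal fractions FF(n): numerator/denominator lists of symbols [S]
-- (S a subset of Fin n), equal iff every symbol has the same exponent
-- (free abelian group on the symbols).

record FF (n : ℕ) : Set where
  constructor _//_
  field
    numF : List (Subset n)
    denF : List (Subset n)
open FF public

WF : ∀ {n} → FF n → Set
WF F = All Nonempty (numF F) × All Nonempty (denF F)

count : ∀ {n} → Subset n → List (Subset n) → ℕ
count S [] = 0
count S (T ∷ Ts) with ≡-dec B._≟_ T S
... | yes _ = suc (count S Ts)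
... | no _ = count S Ts

infix 4 _≈F_
_≈F_ : ∀ {n} → FF n → FF n → Set
F ≈F G = ∀ S → count S (numF F) N.+ count S (denF G) ≡ count S (numF G) N.+ count S (denF F)

infixl 7 _*F_
_*F_ : ∀ {n} → FF n → FF n → FF n
F *F G = (numF F ++ numF G) // (denF F ++ denF G)

symF : ∀ {n} → Subset n → FF n
symF S = (S ∷ []) // []

emptySet : ∀ {n} → Subset n
emptySet = Vec.replicate _ false

⋃over : ∀ {a b} → Subset a → (Fin a → Subset b) → Subset b
⋃over S I = List.foldr _∪_ emptySet
  (List.tabulate (λ k → if Vec.lookup S k then I k else emptySet))

substFF : ∀ {a b} → (Fin a → Subset b) → FF a → FF b
substFF I F = List.map (λ S → ⋃over S I) (numF F) // List.map (λ S → ⋃over S I) (denF F)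

-- S_{i,n} = {i,…,i+n} (0-based, n+1 elements)
blockSet : ∀ {m n} → Fin (suc m) → Subset (suc (m N.+ n))
blockSet {m} {n} i = List.foldr _∪_ emptySet (List.tabulate (λ j → ⁅ gpos {m} {n} i j ⁆))

outerSets : ∀ {m n} → Fin (suc m) → Fin (suc m) → Subset (suc (m N.+ n))
outerSets {m} {n} i k with k F.≟ i
... | yes _ = blockSet {m} {n} i
... | no _  = ⁅ fpos {m} {n} i k ⁆

compFF : ∀ {m n} → Fin (suc m) → FF (suc m) → FF (suc n) → FF (suc (m N.+ n))
compFF {m} {n} i F G =
  symF (blockSet {m} {n} i) *F substFF (outerSets {m} {n} i) F
    *F substFF (λ j → ⁅ gpos {m} {n} i j ⁆) G

unitFF : FF 1
unitFF = [] // (⁅ zero ⁆ ∷ [])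

imageSet : ∀ {n} → Permutation′ n → Subset n → Subset n
imageSet σ S = Vec.tabulate (λ p → Vec.lookup S (σ ⟨$⟩ˡ p))

actFF : ∀ {n} → Permutation′ n → FF n → FF n
actFF σ F = List.map (imageSet σ) (numF F) // List.map (imageSet σ) (denF F)

blockSum : ∀ {m n} → Fin (suc m) → Poly (suc (m N.+ n))
blockSum {m} {n} i = sumP (List.tabulate (λ j → varP (gpos {m} {n} i j)))

blockProd : ∀ {m n} → Fin (suc m) → Poly (suc (m N.+ n))
blockProd {m} {n} i = prodP (List.tabulate (λ j → varP (gpos {m} {n} i j)))

outerArgs : ∀ {m n} → Poly (suc (m N.+ n)) → Fin (suc m) → Fin (suc m) → Poly (suc (m N.+ n))
outerArgs {m} {n} X i k with k F.≟ i
... | yes _ = X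
... | no _  = varP (fpos {m} {n} i k)

comp0 : ∀ {m n} → Fin (suc m) → RatFun (suc m) → RatFun (suc n) → RatFun (suc (m N.+ n))
comp0 {m} {n} i F G =
  polyR (blockSum {m} {n} i) *R substR (outerArgs {m} {n} (blockSum {m} {n} i) i) F
    *R substR (λ j → varP (gpos {m} {n} i j)) G

comp1 : ∀ {m n} → Fin (suc m) → RatFun (suc m) → RatFun (suc n) → RatFun (suc (m N.+ n))
comp1 {m} {n} i F G =
  polyR (blockProd {m} {n} i -P 1P) *R substR (outerArgs {m} {n} (blockProd {m} {n} i) i) F
    *R substR (λ j → varP (gpos {m} {n} i j)) G

unit0 : RatFun 1
unit0 = 1P / varP zero

unit1 : RatFun 1
unit1 = 1P / (varP zero -P 1P)

phi0Sym : ∀ {n} → Subset n → Poly n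
phi0Sym S = sumP (List.tabulate (λ k → if Vec.lookup S k then varP k else 0P))

phi1Sym : ∀ {n} → Subset n → Poly n
phi1Sym S = prodP (List.tabulate (λ k → if Vec.lookup S k then varP k else 1P)) -P 1P

extend : (∀ {n} → Subset n → Poly n) → ∀ {n} → FF n → RatFun n
extend φ F = prodP (List.map φ (numF F)) / prodP (List.map φ (denF F))

phi0 : ∀ {n} → FF n → RatFun n
phi0 = extend phi0Sym

phi1 : ∀ {n} → FF n → RatFun n
phi1 = extend phi1Sym

-- Injective morphism of symmetric set-operads FF^Σ → Set(Mould^Σ)
-- (operads in arities ≥ 1; elements of FF are the well-formed ones)

record IsInjSymOperadMorphism
  (φ : ∀ {n} → FF n → RatFun n)
  (comp : ∀ {m n} → Fin (suc m) → RatFun (suc m) → RatFun (suc n) → RatFun (suc (m N.+ n)))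
  (unit : RatFun 1) : Set where
  field
    valid : ∀ {n} (F : FF n) → WF F → ValidR (φ F)
    respects : ∀ {n} (F G : FF n) → WF F → WF G → F ≈F G → φ F ≈R φ G
    preserves-∘ : ∀ {m n} (i : Fin (suc m)) (F : FF (suc m)) (G : FF (suc n)) →
      WF F → WF G → φ (compFF {m} {n} i F G) ≈R comp {m} {n} i (φ F) (φ G)
    preserves-unit : φ unitFF ≈R unit
    equivariant : ∀ {n} (σ : Permutation′ n) (F : FF n) → WF F →
      φ (actFF σ F) ≈R actR σ (φ F)
    injective : ∀ {n} (F G : FF n) → WF F → WF G → φ F ≈R φ G → F ≈F G

{-# OPTIONS --safe #-}
-- Polynomial identities are verified through the linear functionals ⟪ h ⟫, under
-- which Poly k is a commutative ring and substitution a ring morphism.  Since φ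
-- is multiplicative on formal fractions, compatibility with ∘ᵢ, the units and the
-- symmetric action reduces to single symbols: substituting the sums (products) of
-- the variables over pairwise disjoint sets I_k into φ[S] gives φ[⋃_{k∈S} I_k].
-- Denominators do not vanish at u_j = 2^j (resp. 2^(2^j)), because binary
-- expansions make the subset sums Σ_{j∈T} 2^j distinct and nonzero.  For
-- injectivity, the multiplicity of [S] is recovered as the order of vanishing at
-- t = 0 along a line on which φ[S] becomes t and no other φ[T] vanishes at t = 0.
module Submission where

open import Defs
open import Level using (0ℓ)
open import Data.Nat as ℕ using (ℕ; zero; suc; s≤s; z≤n)
import Data.Nat.Properties as ℕP
open import Data.Nat.Logarithm using (⌊log₂_⌋; ⌊log₂[2^n]⌋≡n)
open import Data.Rational as ℚ using (ℚ; 0ℚ; 1ℚ)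
import Data.Rational.Properties as ℚP
open import Data.Rational.Solver using (module +-*-Solver)
open import Data.Product using (_×_; _,_; proj₁; proj₂; Σ; ∃)
open import Data.Sum using (inj₁)
open import Data.Vec as Vec using (Vec; []; _∷_)
open import Data.Vec.Properties using (≡-dec)
import Data.Vec.Properties as VecP
open import Data.Fin as F using (Fin; zero; suc; toℕ)
import Data.Fin.Properties as FP
open import Data.Fin.Subset using (Subset; ⁅_⁆; _∪_; _∈_; Nonempty)
open import Data.Fin.Subset.Properties using (∉⊥; nonempty?)
open import Data.Fin.Permutation using (Permutation′; _⟨$⟩ʳ_; _⟨$⟩ˡ_; inverseˡ)
open import Data.Bool using (Bool; true; false; if_then_else_; _∨_)
import Data.Bool as B
open import Data.List as List using (List; []; _∷_; _++_)
import Data.List.Properties as ListP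
open import Data.List.Relation.Unary.All using (All; []; _∷_)
open import Data.List.Relation.Unary.All.Properties using (++⁺)
open import Data.Empty using (⊥)
open import Function using (_∘_)
open import Relation.Binary.PropositionalEquality as ≡ using (_≡_; _≗_; refl; cong; cong₂)
open import Relation.Nullary using (¬_; Dec; yes; no; does; contradiction)
open import Algebra.Bundles using (CommutativeMonoid; CommutativeRing)
open import Algebra.Structures using (IsCommutativeRing)
import Algebra.Properties.Group
open import Algebra.Properties.Semiring.Mult (CommutativeRing.semiring ℚP.+-*-commutativeRing)
  using (×-homo-1; ×-homo-+; ×1-homo-*) renaming (_×_ to _×ℚ_)
import Algebra.Properties.CommutativeSemigroup as CommutativeSemigroupProperties
import Algebra.Properties.CommutativeMonoid.Sum as MonoidSum
import Relation.Binary.Reasoning.Setoid as SetoidReasoning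

open +-*-Solver using (solve; _:=_; _:+_; _:*_; :-_; con)
module ℚGroup = Algebra.Properties.Group ℚP.+-0-group

x-y≡0⇒x≡y : ∀ x y → x ℚ.- y ≡ 0ℚ → x ≡ y
x-y≡0⇒x≡y = ℚGroup.x∙y⁻¹≈ε⇒x≈y

*-≢0 : ∀ {a b : ℚ} → ¬ (a ≡ 0ℚ) → ¬ (b ≡ 0ℚ) → ¬ (a ℚ.* b ≡ 0ℚ)
*-≢0 {a} {b} a≢0 b≢0 ab≡0 = b≢0 (begin
  b                     ≡⟨ ℚP.*-identityˡ b ⟨
  1ℚ ℚ.* b              ≡⟨ cong (ℚ._* b) (ℚP.*-inverseˡ a) ⟨
  ℚ.1/ a ℚ.* a ℚ.* b    ≡⟨ ℚP.*-assoc (ℚ.1/ a) a b ⟩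
  ℚ.1/ a ℚ.* (a ℚ.* b)  ≡⟨ cong (ℚ.1/ a ℚ.*_) ab≡0 ⟩
  ℚ.1/ a ℚ.* 0ℚ         ≡⟨ ℚP.*-zeroʳ (ℚ.1/ a) ⟩
  0ℚ                    ∎)
  where
  open ≡.≡-Reasoning
  instance _ = ℚ.≢-nonZero a≢0

-- Linear functionals on polynomials

infixl 6 _⊕_
_⊕_ : ∀ {k} → Mono k → Mono k → Mono k
_⊕_ = Vec.zipWith ℕ._+_

0M : ∀ {k} → Mono k
0M = Vec.replicate _ 0

⊕-comm : ∀ {k} (a b : Mono k) → a ⊕ b ≡ b ⊕ a
⊕-comm []      []      = refl
⊕-comm (x ∷ a) (y ∷ b) = cong₂ _∷_ (ℕP.+-comm x y) (⊕-comm a b)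

⊕-assoc : ∀ {k} (a b c : Mono k) → (a ⊕ b) ⊕ c ≡ a ⊕ (b ⊕ c)
⊕-assoc []      []      []      = refl
⊕-assoc (x ∷ a) (y ∷ b) (z ∷ c) = cong₂ _∷_ (ℕP.+-assoc x y z) (⊕-assoc a b c)

⊕-identityˡ : ∀ {k} (a : Mono k) → 0M ⊕ a ≡ a
⊕-identityˡ []      = refl
⊕-identityˡ (x ∷ a) = cong (x ∷_) (⊕-identityˡ a)

-- ⟪ h ⟫ is the linear functional sending the monomial u^e to h e.  Equality of
-- coefficients (_≈P_) amounts to agreement under all of them (_≋_ below), and in
-- that form the ring laws of the list encoding of Poly become identities in ℚ.
⟪_⟫ : ∀ {k} → (Mono k → ℚ) → Poly k → ℚ
⟪ h ⟫ []            = 0ℚ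
⟪ h ⟫ ((c , e) ∷ p) = c ℚ.* h e ℚ.+ ⟪ h ⟫ p

module _ {k : ℕ} where

  ⟪⟫-cong : ∀ {h g : Mono k → ℚ} → h ≗ g → ∀ p → ⟪ h ⟫ p ≡ ⟪ g ⟫ p
  ⟪⟫-cong h≗g []            = refl
  ⟪⟫-cong h≗g ((c , e) ∷ p) = cong₂ (λ a b → c ℚ.* a ℚ.+ b) (h≗g e) (⟪⟫-cong h≗g p)

  ⟪⟫-++ : ∀ h (p q : Poly k) → ⟪ h ⟫ (p ++ q) ≡ ⟪ h ⟫ p ℚ.+ ⟪ h ⟫ q
  ⟪⟫-++ h []            q = ≡.sym (ℚP.+-identityˡ _)
  ⟪⟫-++ h ((c , e) ∷ p) q = ≡.trans (cong (c ℚ.* h e ℚ.+_) (⟪⟫-++ h p q))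
    (≡.sym (ℚP.+-assoc (c ℚ.* h e) (⟪ h ⟫ p) (⟪ h ⟫ q)))

  ⟪⟫-neg : ∀ h (p : Poly k) → ⟪ h ⟫ (-P p) ≡ ℚ.- ⟪ h ⟫ p
  ⟪⟫-neg h []            = refl
  ⟪⟫-neg h ((c , e) ∷ p) = ≡.trans (cong (ℚ.- c ℚ.* h e ℚ.+_) (⟪⟫-neg h p))
    (solve 3 (λ c x y → :- c :* x :+ :- y := :- (c :* x :+ y)) refl c (h e) (⟪ h ⟫ p))

  ⟪⟫-zero : ∀ (p : Poly k) → ⟪ (λ _ → 0ℚ) ⟫ p ≡ 0ℚ
  ⟪⟫-zero []            = refl
  ⟪⟫-zero ((c , e) ∷ p) = ≡.trans (cong (c ℚ.* 0ℚ ℚ.+_) (⟪⟫-zero p))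
    (solve 1 (λ c → c :* con 0ℚ :+ con 0ℚ := con 0ℚ) refl c)

  ⟪⟫-+ : ∀ (h g : Mono k → ℚ) p → ⟪ (λ e → h e ℚ.+ g e) ⟫ p ≡ ⟪ h ⟫ p ℚ.+ ⟪ g ⟫ p
  ⟪⟫-+ h g []            = ≡.sym (ℚP.+-identityˡ 0ℚ)
  ⟪⟫-+ h g ((c , e) ∷ p) = ≡.trans (cong (c ℚ.* (h e ℚ.+ g e) ℚ.+_) (⟪⟫-+ h g p))
    (solve 5 (λ c x y a b → c :* (x :+ y) :+ (a :+ b) := c :* x :+ a :+ (c :* y :+ b))
      refl c (h e) (g e) (⟪ h ⟫ p) (⟪ g ⟫ p))

  ⟪⟫-scale : ∀ a (h : Mono k → ℚ) p → ⟪ (λ e → a ℚ.* h e) ⟫ p ≡ a ℚ.* ⟪ h ⟫ p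
  ⟪⟫-scale a h []            = ≡.sym (ℚP.*-zeroʳ a)
  ⟪⟫-scale a h ((c , e) ∷ p) = ≡.trans (cong (c ℚ.* (a ℚ.* h e) ℚ.+_) (⟪⟫-scale a h p))
    (solve 4 (λ a c x y → c :* (a :* x) :+ a :* y := a :* (c :* x :+ y)) refl a c (h e) (⟪ h ⟫ p))

  ⟪⟫-*P : ∀ h (p q : Poly k) → ⟪ h ⟫ (p *P q) ≡ ⟪ (λ e → ⟪ (λ e′ → h (e ⊕ e′)) ⟫ q) ⟫ p
  ⟪⟫-*P h []            q = refl
  ⟪⟫-*P h ((c , e) ∷ p) q = ≡.trans (⟪⟫-++ h (List.map (λ s → (c ℚ.* proj₁ s , e ⊕ proj₂ s)) q) (p *P q))
    (cong₂ ℚ._+_ (⟪⟫-monomial* q) (⟪⟫-*P h p q))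
    where
    ⟪⟫-monomial* : ∀ r → ⟪ h ⟫ (List.map (λ s → (c ℚ.* proj₁ s , e ⊕ proj₂ s)) r)
                       ≡ c ℚ.* ⟪ (λ e′ → h (e ⊕ e′)) ⟫ r
    ⟪⟫-monomial* []             = ≡.sym (ℚP.*-zeroʳ c)
    ⟪⟫-monomial* ((d , e′) ∷ r) = ≡.trans (cong (c ℚ.* d ℚ.* h (e ⊕ e′) ℚ.+_) (⟪⟫-monomial* r))
      (solve 4 (λ c d x y → c :* d :* x :+ c :* y := c :* (d :* x :+ y))
        refl c d (h (e ⊕ e′)) (⟪ (λ e′ → h (e ⊕ e′)) ⟫ r))

  ⟪⟫-constP : ∀ h (c : ℚ) → ⟪ h ⟫ (constP {k} c) ≡ c ℚ.* h 0M
  ⟪⟫-constP h c = ℚP.+-identityʳ _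

⟪⟫-swap : ∀ {a b} (f : Mono a → Mono b → ℚ) p q →
  ⟪ (λ e → ⟪ f e ⟫ q) ⟫ p ≡ ⟪ (λ e′ → ⟪ (λ e → f e e′) ⟫ p) ⟫ q
⟪⟫-swap f []            q = ≡.sym (⟪⟫-zero q)
⟪⟫-swap f ((c , e) ∷ p) q = ≡.sym (≡.trans
  (⟪⟫-+ (λ e′ → c ℚ.* f e e′) (λ e′ → ⟪ (λ e₁ → f e₁ e′) ⟫ p) q)
  (cong₂ ℚ._+_ (⟪⟫-scale c (f e) q) (≡.sym (⟪⟫-swap f p q))))

δ : ∀ {k} → Mono k → Mono k → ℚ
δ m e with ≡-dec ℕ._≟_ e m
... | yes _ = 1ℚ
... | no  _ = 0ℚ

coeff≡⟪δ⟫ : ∀ {k} (p : Poly k) m → coeff p m ≡ ⟪ δ m ⟫ p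
coeff≡⟪δ⟫ []            m = refl
coeff≡⟪δ⟫ ((c , e) ∷ p) m with ≡-dec ℕ._≟_ e m
... | yes _ = cong₂ ℚ._+_ (≡.sym (ℚP.*-identityʳ c)) (coeff≡⟪δ⟫ p m)
... | no  _ = ≡.trans (coeff≡⟪δ⟫ p m)
  (≡.sym (≡.trans (cong (ℚ._+ ⟪ δ m ⟫ p) (ℚP.*-zeroʳ c)) (ℚP.+-identityˡ _)))

module _ {k : ℕ} where

  without : Mono k → Poly k → Poly k
  without e [] = []
  without e ((c , e′) ∷ r) with ≡-dec ℕ._≟_ e′ e
  ... | yes _ = without e r
  ... | no  _ = (c , e′) ∷ without e r

  ⟪⟫-split : ∀ h (e : Mono k) r → ⟪ h ⟫ r ≡ coeff r e ℚ.* h e ℚ.+ ⟪ h ⟫ (without e r)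
  ⟪⟫-split h e [] = solve 1 (λ x → con 0ℚ := con 0ℚ :* x :+ con 0ℚ) refl (h e)
  ⟪⟫-split h e ((c , e′) ∷ r) with ≡-dec ℕ._≟_ e′ e
  ... | yes refl = ≡.trans (cong (c ℚ.* h e′ ℚ.+_) (⟪⟫-split h e′ r))
    (solve 4 (λ c x a y → c :* x :+ (a :* x :+ y) := (c :+ a) :* x :+ y)
      refl c (h e′) (coeff r e′) (⟪ h ⟫ (without e′ r)))
  ... | no _ = ≡.trans (cong (c ℚ.* h e′ ℚ.+_) (⟪⟫-split h e r))
    (solve 5 (λ c x a z y → c :* x :+ (a :* z :+ y) := a :* z :+ (c :* x :+ y))
      refl c (h e′) (coeff r e) (h e) (⟪ h ⟫ (without e r)))

  length-without : ∀ (e : Mono k) r → List.length (without e r) ℕ.≤ List.length r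
  length-without e [] = z≤n
  length-without e ((c , e′) ∷ r) with ≡-dec ℕ._≟_ e′ e
  ... | yes _ = ℕP.m≤n⇒m≤1+n (length-without e r)
  ... | no  _ = s≤s (length-without e r)

  length-without-∷ : ∀ (e : Mono k) c r → List.length (without e ((c , e) ∷ r)) ℕ.≤ List.length r
  length-without-∷ e c r with ≡-dec ℕ._≟_ e e
  ... | yes _ = length-without e r
  ... | no e≢e = contradiction refl e≢e

  coeff-without-same : ∀ (e : Mono k) r → coeff (without e r) e ≡ 0ℚ
  coeff-without-same e [] = refl
  coeff-without-same e ((c , e′) ∷ r) with ≡-dec ℕ._≟_ e′ e
  ... | yes _ = coeff-without-same e r
  ... | no e′≢e with ≡-dec ℕ._≟_ e′ e
  ...   | yes e′≡e = contradiction e′≡e e′≢e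
  ...   | no  _    = coeff-without-same e r

  coeff-without-other : ∀ (e m : Mono k) r → ¬ (m ≡ e) → coeff (without e r) m ≡ coeff r m
  coeff-without-other e m [] _ = refl
  coeff-without-other e m ((c , e′) ∷ r) m≢e with ≡-dec ℕ._≟_ e′ e
  ... | yes refl with ≡-dec ℕ._≟_ e′ m
  ...   | yes refl = contradiction refl m≢e
  ...   | no  _    = coeff-without-other e m r m≢e
  coeff-without-other e m ((c , e′) ∷ r) m≢e | no _ with ≡-dec ℕ._≟_ e′ m
  ...   | yes _ = cong (c ℚ.+_) (coeff-without-other e m r m≢e)
  ...   | no  _ = coeff-without-other e m r m≢e

  coeff≡0⇒⟪⟫≡0 : ∀ (r : Poly k) → (∀ m → coeff r m ≡ 0ℚ) → ∀ h → ⟪ h ⟫ r ≡ 0ℚ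
  coeff≡0⇒⟪⟫≡0 r = go (List.length r) r ℕP.≤-refl
    where
    go : ∀ n r → List.length r ℕ.≤ n → (∀ m → coeff r m ≡ 0ℚ) → ∀ h → ⟪ h ⟫ r ≡ 0ℚ
    go _ [] _ _ h = refl
    go (suc n) r@((c , e) ∷ r′) (s≤s |r′|≤n) coeff≡0 h = begin
      ⟪ h ⟫ r                                    ≡⟨ ⟪⟫-split h e r ⟩
      coeff r e ℚ.* h e ℚ.+ ⟪ h ⟫ (without e r)  ≡⟨ cong₂ (λ a b → a ℚ.* h e ℚ.+ b) (coeff≡0 e) rest≡0 ⟩
      0ℚ ℚ.* h e ℚ.+ 0ℚ                          ≡⟨ solve 1 (λ x → con 0ℚ :* x :+ con 0ℚ := con 0ℚ) refl (h e) ⟩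
      0ℚ                                         ∎
      where
      open ≡.≡-Reasoning
      coeff-rest≡0 : ∀ m → coeff (without e r) m ≡ 0ℚ
      coeff-rest≡0 m with ≡-dec ℕ._≟_ m e
      ... | yes refl = coeff-without-same m r
      ... | no m≢e  = ≡.trans (coeff-without-other e m r m≢e) (coeff≡0 m)
      rest≡0 : ⟪ h ⟫ (without e r) ≡ 0ℚ
      rest≡0 = go n (without e r) (ℕP.≤-trans (length-without-∷ e c r′) |r′|≤n) coeff-rest≡0 h

infix 4 _≋_
record _≋_ {k} (p q : Poly k) : Set where
  constructor mk≋
  field agree : ∀ h → ⟪ h ⟫ p ≡ ⟪ h ⟫ q
open _≋_ public

≈P⇒≋ : ∀ {k} {p q : Poly k} → p ≈P q → p ≋ q
≈P⇒≋ {p = p} {q} p≈q = mk≋ λ h → x-y≡0⇒x≡y (⟪ h ⟫ p) (⟪ h ⟫ q) (begin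
  ⟪ h ⟫ p ℚ.- ⟪ h ⟫ q        ≡⟨ cong (⟪ h ⟫ p ℚ.+_) (⟪⟫-neg h q) ⟨
  ⟪ h ⟫ p ℚ.+ ⟪ h ⟫ (-P q)   ≡⟨ ⟪⟫-++ h p (-P q) ⟨
  ⟪ h ⟫ (p -P q)             ≡⟨ coeff≡0⇒⟪⟫≡0 (p -P q) coeff≡0 h ⟩
  0ℚ                         ∎)
  where
  open ≡.≡-Reasoning
  coeff≡0 : ∀ m → coeff (p -P q) m ≡ 0ℚ
  coeff≡0 m = begin
    coeff (p -P q) m                  ≡⟨ coeff≡⟪δ⟫ (p -P q) m ⟩
    ⟪ δ m ⟫ (p -P q)                  ≡⟨ ⟪⟫-++ (δ m) p (-P q) ⟩
    ⟪ δ m ⟫ p ℚ.+ ⟪ δ m ⟫ (-P q)      ≡⟨ cong₂ ℚ._+_ (≡.sym (coeff≡⟪δ⟫ p m)) (⟪⟫-neg (δ m) q) ⟩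
    coeff p m ℚ.- ⟪ δ m ⟫ q           ≡⟨ cong₂ ℚ._-_ (p≈q m) (≡.sym (coeff≡⟪δ⟫ q m)) ⟩
    coeff q m ℚ.- coeff q m           ≡⟨ ℚP.+-inverseʳ (coeff q m) ⟩
    0ℚ                                ∎

≋⇒≈P : ∀ {k} {p q : Poly k} → p ≋ q → p ≈P q
≋⇒≈P {p = p} {q} p≋q m = ≡.trans (coeff≡⟪δ⟫ p m) (≡.trans (agree p≋q (δ m)) (≡.sym (coeff≡⟪δ⟫ q m)))

-- The polynomial ring

module _ {k : ℕ} where

  ≋-reflexive : {p q : Poly k} → p ≡ q → p ≋ q
  ≋-reflexive refl = mk≋ λ _ → refl

  ≋-sym : {p q : Poly k} → p ≋ q → q ≋ p
  ≋-sym p≋q = mk≋ λ h → ≡.sym (agree p≋q h)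

  ≋-trans : {p q r : Poly k} → p ≋ q → q ≋ r → p ≋ r
  ≋-trans p≋q q≋r = mk≋ λ h → ≡.trans (agree p≋q h) (agree q≋r h)

  +P-cong : {p p′ q q′ : Poly k} → p ≋ p′ → q ≋ q′ → p +P q ≋ p′ +P q′
  +P-cong {p} {p′} {q} {q′} p≋p′ q≋q′ = mk≋ λ h → ≡.trans (⟪⟫-++ h p q)
    (≡.trans (cong₂ ℚ._+_ (agree p≋p′ h) (agree q≋q′ h)) (≡.sym (⟪⟫-++ h p′ q′)))

  +P-comm : (p q : Poly k) → p +P q ≋ q +P p
  +P-comm p q = mk≋ λ h →
    ≡.trans (⟪⟫-++ h p q) (≡.trans (ℚP.+-comm (⟪ h ⟫ p) (⟪ h ⟫ q)) (≡.sym (⟪⟫-++ h q p)))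

  -P-cong : {p q : Poly k} → p ≋ q → -P p ≋ -P q
  -P-cong {p} {q} p≋q = mk≋ λ h →
    ≡.trans (⟪⟫-neg h p) (≡.trans (cong ℚ.-_ (agree p≋q h)) (≡.sym (⟪⟫-neg h q)))

  -P-inverseˡ : (p : Poly k) → (-P p) +P p ≋ 0P
  -P-inverseˡ p = mk≋ λ h → ≡.trans (⟪⟫-++ h (-P p) p)
    (≡.trans (cong (ℚ._+ ⟪ h ⟫ p) (⟪⟫-neg h p)) (ℚP.+-inverseˡ (⟪ h ⟫ p)))

  -P-inverseʳ : (p : Poly k) → p +P (-P p) ≋ 0P
  -P-inverseʳ p = ≋-trans (+P-comm p (-P p)) (-P-inverseˡ p)

  *P-cong : {p p′ q q′ : Poly k} → p ≋ p′ → q ≋ q′ → p *P q ≋ p′ *P q′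
  *P-cong {p} {p′} {q} {q′} p≋p′ q≋q′ = mk≋ λ h → begin
    ⟪ h ⟫ (p *P q)                                  ≡⟨ ⟪⟫-*P h p q ⟩
    ⟪ (λ e → ⟪ (λ e′ → h (e ⊕ e′)) ⟫ q) ⟫ p         ≡⟨ agree p≋p′ _ ⟩
    ⟪ (λ e → ⟪ (λ e′ → h (e ⊕ e′)) ⟫ q) ⟫ p′        ≡⟨ ⟪⟫-cong (λ e → agree q≋q′ (λ e′ → h (e ⊕ e′))) p′ ⟩
    ⟪ (λ e → ⟪ (λ e′ → h (e ⊕ e′)) ⟫ q′) ⟫ p′       ≡⟨ ⟪⟫-*P h p′ q′ ⟨
    ⟪ h ⟫ (p′ *P q′)                                ∎
    where open ≡.≡-Reasoning

  *P-comm : (p q : Poly k) → p *P q ≋ q *P p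
  *P-comm p q = mk≋ λ h → begin
    ⟪ h ⟫ (p *P q)                                  ≡⟨ ⟪⟫-*P h p q ⟩
    ⟪ (λ e → ⟪ (λ e′ → h (e ⊕ e′)) ⟫ q) ⟫ p         ≡⟨ ⟪⟫-swap (λ e e′ → h (e ⊕ e′)) p q ⟩
    ⟪ (λ e′ → ⟪ (λ e → h (e ⊕ e′)) ⟫ p) ⟫ q         ≡⟨ ⟪⟫-cong (λ e′ → ⟪⟫-cong (λ e → cong h (⊕-comm e e′)) p) q ⟩
    ⟪ (λ e′ → ⟪ (λ e → h (e′ ⊕ e)) ⟫ p) ⟫ q         ≡⟨ ⟪⟫-*P h q p ⟨
    ⟪ h ⟫ (q *P p)                                  ∎
    where open ≡.≡-Reasoning

  *P-assoc : (p q r : Poly k) → (p *P q) *P r ≋ p *P (q *P r)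
  *P-assoc p q r = mk≋ λ h → begin
    ⟪ h ⟫ ((p *P q) *P r)
      ≡⟨ ≡.trans (⟪⟫-*P h (p *P q) r) (⟪⟫-*P _ p q) ⟩
    ⟪ (λ a → ⟪ (λ b → ⟪ (λ c → h ((a ⊕ b) ⊕ c)) ⟫ r) ⟫ q) ⟫ p
      ≡⟨ ⟪⟫-cong (λ a → ⟪⟫-cong (λ b → ⟪⟫-cong (λ c → cong h (⊕-assoc a b c)) r) q) p ⟩
    ⟪ (λ a → ⟪ (λ b → ⟪ (λ c → h (a ⊕ (b ⊕ c))) ⟫ r) ⟫ q) ⟫ p
      ≡⟨ ⟪⟫-cong (λ a → ⟪⟫-*P (λ x → h (a ⊕ x)) q r) p ⟨
    ⟪ (λ a → ⟪ (λ x → h (a ⊕ x)) ⟫ (q *P r)) ⟫ p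
      ≡⟨ ⟪⟫-*P h p (q *P r) ⟨
    ⟪ h ⟫ (p *P (q *P r))
      ∎
    where open ≡.≡-Reasoning

  *P-identityˡ : (p : Poly k) → 1P *P p ≋ p
  *P-identityˡ p = mk≋ λ h → begin
    ⟪ h ⟫ (1P *P p)                           ≡⟨ ⟪⟫-*P h 1P p ⟩
    1ℚ ℚ.* ⟪ (λ e′ → h (0M ⊕ e′)) ⟫ p ℚ.+ 0ℚ  ≡⟨ ≡.trans (ℚP.+-identityʳ _) (ℚP.*-identityˡ _) ⟩
    ⟪ (λ e′ → h (0M ⊕ e′)) ⟫ p                ≡⟨ ⟪⟫-cong (λ e → cong h (⊕-identityˡ e)) p ⟩
    ⟪ h ⟫ p                                   ∎
    where open ≡.≡-Reasoning

  *P-distribˡ : (p q r : Poly k) → p *P (q +P r) ≋ p *P q +P p *P r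
  *P-distribˡ p q r = mk≋ λ h → begin
    ⟪ h ⟫ (p *P (q +P r))
      ≡⟨ ≡.trans (⟪⟫-*P h p (q +P r)) (⟪⟫-cong (λ e → ⟪⟫-++ _ q r) p) ⟩
    ⟪ (λ e → ⟪ (λ e′ → h (e ⊕ e′)) ⟫ q ℚ.+ ⟪ (λ e′ → h (e ⊕ e′)) ⟫ r) ⟫ p
      ≡⟨ ⟪⟫-+ _ _ p ⟩
    ⟪ (λ e → ⟪ (λ e′ → h (e ⊕ e′)) ⟫ q) ⟫ p ℚ.+ ⟪ (λ e → ⟪ (λ e′ → h (e ⊕ e′)) ⟫ r) ⟫ p
      ≡⟨ cong₂ ℚ._+_ (⟪⟫-*P h p q) (⟪⟫-*P h p r) ⟨
    ⟪ h ⟫ (p *P q) ℚ.+ ⟪ h ⟫ (p *P r)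
      ≡⟨ ⟪⟫-++ h (p *P q) (p *P r) ⟨
    ⟪ h ⟫ (p *P q +P p *P r)
      ∎
    where open ≡.≡-Reasoning

  +P-*P-isCommutativeRing : IsCommutativeRing (_≋_ {k}) _+P_ _*P_ -P_ 0P 1P
  +P-*P-isCommutativeRing = record
    { isRing = record
      { +-isAbelianGroup = record
        { isGroup = record
          { isMonoid = record
            { isSemigroup = record
              { isMagma = record
                { isEquivalence = record { refl = ≋-reflexive refl ; sym = ≋-sym ; trans = ≋-trans }
                ; ∙-cong = +P-cong }
              ; assoc = λ p q r → ≋-reflexive (ListP.++-assoc p q r) }
            ; identity = (λ p → ≋-reflexive refl) , (λ p → ≋-reflexive (ListP.++-identityʳ p)) }
          ; inverse = -P-inverseˡ , -P-inverseʳ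
          ; ⁻¹-cong = -P-cong }
        ; comm = +P-comm }
      ; *-cong = *P-cong
      ; *-assoc = *P-assoc
      ; *-identity = *P-identityˡ , (λ p → ≋-trans (*P-comm p 1P) (*P-identityˡ p))
      ; distrib = *P-distribˡ
                , (λ p q r → ≋-trans (*P-comm (q +P r) p) (≋-trans (*P-distribˡ p q r)
                               (+P-cong (*P-comm p q) (*P-comm p r)))) }
    ; *-comm = *P-comm }

polyRing : ℕ → CommutativeRing 0ℓ 0ℓ
polyRing k = record { isCommutativeRing = +P-*P-isCommutativeRing {k} }

module R₁ = CommutativeRing (polyRing 1)

-- Finite sums over subsets

any : ∀ {n} → (Fin n → Bool) → Bool
any {zero}  c = false
any {suc n} c = c zero ∨ any (c ∘ suc)

-- ⋃over and blockSet of Defs unfold to instances of this fold.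
⋃ : ∀ {a b} → (Fin a → Subset b) → Subset b
⋃ J = List.foldr _∪_ emptySet (List.tabulate J)

PairwiseDisjoint : ∀ {a b} → (Fin a → Subset b) → Set
PairwiseDisjoint J = ∀ k k′ p → Vec.lookup (J k) p ≡ true → Vec.lookup (J k′) p ≡ true → k ≡ k′

lookup-∅ : ∀ {b} (p : Fin b) → Vec.lookup (emptySet {b}) p ≡ false
lookup-∅ p = VecP.lookup-replicate p false

lookup-⋃ : ∀ {a b} (J : Fin a → Subset b) p → Vec.lookup (⋃ J) p ≡ any (λ k → Vec.lookup (J k) p)
lookup-⋃ {zero}  J p = lookup-∅ p
lookup-⋃ {suc a} J p = ≡.trans (VecP.lookup-zipWith _∨_ p (J zero) (⋃ (J ∘ suc)))
  (cong (Vec.lookup (J zero) p ∨_) (lookup-⋃ (J ∘ suc) p))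

lookup-⁅⁆ : ∀ {b} (q p : Fin b) → Vec.lookup ⁅ q ⁆ p ≡ does (p F.≟ q)
lookup-⁅⁆ zero    zero    = refl
lookup-⁅⁆ zero    (suc p) = lookup-∅ p
lookup-⁅⁆ (suc q) zero    = refl
lookup-⁅⁆ (suc q) (suc p) = lookup-⁅⁆ q p

lookup-⁅⁆⇒≡ : ∀ {b} (q p : Fin b) → Vec.lookup ⁅ q ⁆ p ≡ true → p ≡ q
lookup-⁅⁆⇒≡ q p q∋p with p F.≟ q | lookup-⁅⁆ q p
... | yes p≡q | _   = p≡q
... | no  _   | q∌p = contradiction (≡.trans (≡.sym q∌p) q∋p) (λ ())

any⇒∃ : ∀ {n} (c : Fin n → Bool) → any c ≡ true → ∃ λ k → c k ≡ true
any⇒∃ {suc n} c any≡true with c zero in c₀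
... | true  = zero , c₀
... | false = let (k , cₖ) = any⇒∃ (c ∘ suc) any≡true in suc k , cₖ

module FinSum {c ℓ} (M : CommutativeMonoid c ℓ) where
  open CommutativeMonoid M renaming (refl to ≈-refl)
  open MonoidSum M public
  open SetoidReasoning setoid

  sumOver : ∀ {n} → Subset n → (Fin n → Carrier) → Carrier
  sumOver T f = sum (λ j → if Vec.lookup T j then f j else ε)

  sumOver-cong : ∀ {n} (T : Subset n) {f g : Fin n → Carrier} → (∀ j → f j ≈ g j) → sumOver T f ≈ sumOver T g
  sumOver-cong T f≈g = sum-cong-≋ (λ j → select-cong (Vec.lookup T j) (f≈g j))
    where
    select-cong : ∀ b {x y} → x ≈ y → (if b then x else ε) ≈ (if b then y else ε)
    select-cong true  x≈y = x≈y
    select-cong false _   = ≈-refl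

  sum-δ : ∀ {n} (x : Fin n → Carrier) (j : Fin n) → sum (λ l → if does (l F.≟ j) then x l else ε) ≈ x j
  sum-δ {suc n} x zero    = trans (∙-congˡ (sum-replicate-zero n)) (identityʳ _)
  sum-δ {suc n} x (suc j) = trans (identityˡ _) (sum-δ (x ∘ suc) j)

  sumOver-∙ : ∀ {n} (T : Subset n) (f g : Fin n → Carrier) →
    sumOver T (λ j → f j ∙ g j) ≈ sumOver T f ∙ sumOver T g
  sumOver-∙ T f g = trans (sum-cong-≋ (λ j → select-∙ (Vec.lookup T j) (f j) (g j)))
    (∑-distrib-+ (λ j → if Vec.lookup T j then f j else ε) (λ j → if Vec.lookup T j then g j else ε))
    where
    select-∙ : ∀ b x y → (if b then x ∙ y else ε) ≈ (if b then x else ε) ∙ (if b then y else ε)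
    select-∙ true  x y = ≈-refl
    select-∙ false x y = sym (identityˡ ε)

  sumOver-δ : ∀ {n} (T : Subset n) (s : Fin n) y →
    sumOver T (λ j → if does (j F.≟ s) then y else ε) ≈ (if Vec.lookup T s then y else ε)
  sumOver-δ T s y = trans (sum-cong-≋ (λ j → select-comm (Vec.lookup T j) (does (j F.≟ s))))
    (sum-δ (λ j → if Vec.lookup T j then y else ε) s)
    where
    select-comm : ∀ b b′ → (if b then (if b′ then y else ε) else ε) ≈ (if b′ then (if b then y else ε) else ε)
    select-comm true  true  = ≈-refl
    select-comm true  false = ≈-refl
    select-comm false true  = ≈-refl
    select-comm false false = ≈-refl

  sumOver-∅ : ∀ {n} (f : Fin n → Carrier) → sumOver emptySet f ≈ ε
  sumOver-∅ {n} f = trans (reflexive (sum-cong-≗ (λ p → cong (λ b → if b then f p else ε) (lookup-∅ p))))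
    (sum-replicate-zero n)

  sumOver-⁅⁆ : ∀ {n} (f : Fin n → Carrier) q → sumOver ⁅ q ⁆ f ≈ f q
  sumOver-⁅⁆ f q = trans (reflexive (sum-cong-≗ (λ p → cong (λ b → if b then f p else ε) (lookup-⁅⁆ q p))))
    (sum-δ f q)

  sum-select-unique : ∀ {a} (c : Fin a → Bool) y → (∀ k k′ → c k ≡ true → c k′ ≡ true → k ≡ k′) →
    sum (λ k → if c k then y else ε) ≈ (if any c then y else ε)
  sum-select-unique {zero}  c y unique = ≈-refl
  sum-select-unique {suc a} c y unique with c zero in c₀
  ... | true  = trans (∙-congˡ (trans (sum-cong-≋ rest≈ε) (sum-replicate-zero a))) (identityʳ y)
    where
    rest≈ε : ∀ k → (if c (suc k) then y else ε) ≈ ε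
    rest≈ε k with c (suc k) in cₖ
    ... | true  = contradiction (unique zero (suc k) c₀ cₖ) (λ ())
    ... | false = ≈-refl
  ... | false = trans (identityˡ _)
    (sum-select-unique (c ∘ suc) y (λ k k′ cₖ cₖ′ → FP.suc-injective (unique (suc k) (suc k′) cₖ cₖ′)))

  sumOver-⋃ : ∀ {a b} (f : Fin b → Carrier) (J : Fin a → Subset b) → PairwiseDisjoint J →
    sum (λ k → sumOver (J k) f) ≈ sumOver (⋃ J) f
  sumOver-⋃ f J disjoint = begin
    sum (λ k → sumOver (J k) f)
      ≈⟨ ∑-comm (λ k p → if Vec.lookup (J k) p then f p else ε) ⟩
    sum (λ p → sum (λ k → if Vec.lookup (J k) p then f p else ε))
      ≈⟨ sum-cong-≋ (λ p → sum-select-unique (λ k → Vec.lookup (J k) p) (f p) (λ k k′ → disjoint k k′ p)) ⟩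
    sum (λ p → if any (λ k → Vec.lookup (J k) p) then f p else ε)
      ≡⟨ sum-cong-≗ (λ p → cong (λ b → if b then f p else ε) (≡.sym (lookup-⋃ J p))) ⟩
    sumOver (⋃ J) f ∎

  sumOver-⋃over : ∀ {a b} (f : Fin b → Carrier) (S : Subset a) (I : Fin a → Subset b) → PairwiseDisjoint I →
    sumOver S (λ k → sumOver (I k) f) ≈ sumOver (⋃over S I) f
  sumOver-⋃over f S I disjoint = trans (sum-cong-≋ (λ k → select-sumOver k (Vec.lookup S k)))
    (sumOver-⋃ f (λ k → if Vec.lookup S k then I k else emptySet) disjoint′)
    where
    select-sumOver : ∀ k b → (if b then sumOver (I k) f else ε) ≈ sumOver (if b then I k else emptySet) f
    select-sumOver k true  = ≈-refl
    select-sumOver k false = sym (sumOver-∅ f)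
    ⊆I : ∀ k p → Vec.lookup (if Vec.lookup S k then I k else emptySet) p ≡ true → Vec.lookup (I k) p ≡ true
    ⊆I k p p∈ with Vec.lookup S k
    ... | true  = p∈
    ... | false = contradiction (≡.trans (≡.sym (lookup-∅ p)) p∈) (λ ())
    disjoint′ : PairwiseDisjoint (λ k → if Vec.lookup S k then I k else emptySet)
    disjoint′ k k′ p p∈ p∈′ = disjoint k k′ p (⊆I k p p∈) (⊆I k′ p p∈′)

  sum-≈-sumOver-⋃⁅⁆ : ∀ {a b} (f : Fin b → Carrier) (g : Fin a → Fin b) → PairwiseDisjoint (λ j → ⁅ g j ⁆) →
    sum (f ∘ g) ≈ sumOver (⋃ (λ j → ⁅ g j ⁆)) f
  sum-≈-sumOver-⋃⁅⁆ f g disjoint = trans (sum-cong-≋ (λ j → sym (sumOver-⁅⁆ f (g j)))) (sumOver-⋃ f _ disjoint)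

  sumOver-imageSet : ∀ {n} (π : Permutation′ n) (T : Subset n) (f : Fin n → Carrier) →
    sumOver (imageSet π T) f ≈ sumOver T (f ∘ (π ⟨$⟩ʳ_))
  sumOver-imageSet π T f = begin
    sumOver (imageSet π T) f
      ≡⟨ sum-cong-≗ (λ p → cong (λ b → if b then f p else ε) (VecP.lookup∘tabulate _ p)) ⟩
    sum (λ p → if Vec.lookup T (π ⟨$⟩ˡ p) then f p else ε)
      ≈⟨ ∑-permute (λ p → if Vec.lookup T (π ⟨$⟩ˡ p) then f p else ε) π ⟩
    sum (λ j → if Vec.lookup T (π ⟨$⟩ˡ (π ⟨$⟩ʳ j)) then f (π ⟨$⟩ʳ j) else ε)
      ≡⟨ sum-cong-≗ (λ j → cong (λ q → if Vec.lookup T q then f (π ⟨$⟩ʳ j) else ε) (inverseˡ π)) ⟩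
    sumOver T (f ∘ (π ⟨$⟩ʳ_)) ∎

module _ {c₁ ℓ₁ c₂ ℓ₂} (M : CommutativeMonoid c₁ ℓ₁) (N : CommutativeMonoid c₂ ℓ₂) where
  private
    module M = CommutativeMonoid M
    module N = CommutativeMonoid N
    module ΣM = FinSum M
    module ΣN = FinSum N

  module _ (f : M.Carrier → N.Carrier) (f-∙ : ∀ x y → f (x M.∙ y) N.≈ f x N.∙ f y) (f-ε : f M.ε N.≈ N.ε) where

    sum-homo : ∀ {n} (g : Fin n → M.Carrier) → f (ΣM.sum g) N.≈ ΣN.sum (f ∘ g)
    sum-homo {zero}  g = f-ε
    sum-homo {suc n} g = N.trans (f-∙ (g zero) (ΣM.sum (g ∘ suc))) (N.∙-congˡ (sum-homo (g ∘ suc)))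

    sumOver-homo : ∀ {n} (T : Subset n) (g : Fin n → M.Carrier) → f (ΣM.sumOver T g) N.≈ ΣN.sumOver T (f ∘ g)
    sumOver-homo T g = N.trans (sum-homo (λ j → if Vec.lookup T j then g j else M.ε))
      (ΣN.sum-cong-≋ (λ j → select-homo (Vec.lookup T j)))
      where
      select-homo : ∀ b {x} → f (if b then x else M.ε) N.≈ (if b then f x else N.ε)
      select-homo true  = N.refl
      select-homo false = f-ε

-- Constants and substitution

module ΣP {k : ℕ} = FinSum (CommutativeRing.+-commutativeMonoid (polyRing k))
module ΠP {k : ℕ} = FinSum (CommutativeRing.*-commutativeMonoid (polyRing k))
module Σℚ = FinSum ℚP.+-0-commutativeMonoid
module Πℚ = FinSum ℚP.*-1-commutativeMonoid

module _ {k : ℕ} where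
  private module R = CommutativeRing (polyRing k)

  sumP-tabulate : ∀ {n} (f : Fin n → Poly k) → sumP (List.tabulate f) ≡ ΣP.sum f
  sumP-tabulate {zero}  f = refl
  sumP-tabulate {suc n} f = cong (f zero ++_) (sumP-tabulate (f ∘ suc))

  prodP-tabulate : ∀ {n} (f : Fin n → Poly k) → prodP (List.tabulate f) ≡ ΠP.sum f
  prodP-tabulate {zero}  f = refl
  prodP-tabulate {suc n} f = cong (f zero *P_) (prodP-tabulate (f ∘ suc))

  phi0Sym≡sumOver : (S : Subset k) → phi0Sym S ≡ ΣP.sumOver S varP
  phi0Sym≡sumOver S = sumP-tabulate (λ p → if Vec.lookup S p then varP p else 0P)

  phi1Sym≡prodOver-1 : (S : Subset k) → phi1Sym S ≡ ΠP.sumOver S varP -P 1P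
  phi1Sym≡prodOver-1 S = cong (_-P 1P) (prodP-tabulate (λ p → if Vec.lookup S p then varP p else 1P))

  ⟪⟫-constP*P : ∀ h c (p : Poly k) → ⟪ h ⟫ (constP c *P p) ≡ c ℚ.* ⟪ h ⟫ p
  ⟪⟫-constP*P h c p = ≡.trans (⟪⟫-*P h (constP c) p)
    (≡.trans (ℚP.+-identityʳ _) (cong (c ℚ.*_) (⟪⟫-cong (λ e → cong h (⊕-identityˡ e)) p)))

  constP-+ : ∀ a b → constP {k} (a ℚ.+ b) ≋ constP a +P constP b
  constP-+ a b = mk≋ λ h → ≡.trans (⟪⟫-constP h (a ℚ.+ b)) (≡.sym (≡.trans (⟪⟫-++ h (constP a) (constP b))
    (≡.trans (cong₂ ℚ._+_ (⟪⟫-constP h a) (⟪⟫-constP h b)) (≡.sym (ℚP.*-distribʳ-+ (h 0M) a b)))))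

  constP-* : ∀ a b → constP {k} (a ℚ.* b) ≋ constP a *P constP b
  constP-* a b = mk≋ λ h → ≡.trans (⟪⟫-constP h (a ℚ.* b)) (≡.sym (≡.trans (⟪⟫-constP*P h a (constP b))
    (≡.trans (cong (a ℚ.*_) (⟪⟫-constP h b)) (≡.sym (ℚP.*-assoc a b (h 0M))))))

  constP-0 : constP {k} 0ℚ ≋ 0P
  constP-0 = mk≋ λ h → ≡.trans (⟪⟫-constP h 0ℚ) (ℚP.*-zeroˡ (h 0M))

  constP-sumOver : ∀ {n} (T : Subset n) (f : Fin n → ℚ) → ΣP.sumOver T (constP ∘ f) ≋ constP {k} (Σℚ.sumOver T f)
  constP-sumOver T f = R.sym (sumOver-homo ℚP.+-0-commutativeMonoid R.+-commutativeMonoid constP constP-+ constP-0 T f)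

  constP-prodOver : ∀ {n} (T : Subset n) (f : Fin n → ℚ) → ΠP.sumOver T (constP ∘ f) ≋ constP {k} (Πℚ.sumOver T f)
  constP-prodOver T f = R.sym (sumOver-homo ℚP.*-1-commutativeMonoid R.*-commutativeMonoid constP constP-* R.refl T f)

  powP-+ : ∀ (x : Poly k) m n → powP x (m ℕ.+ n) ≋ powP x m *P powP x n
  powP-+ x zero    n = R.sym (R.*-identityˡ (powP x n))
  powP-+ x (suc m) n = R.trans (R.*-congˡ {x} (powP-+ x m n)) (R.sym (R.*-assoc x (powP x m) (powP x n)))

monomialAt : ∀ {k r} → (Fin k → Poly r) → Mono k → Poly r
monomialAt σ e = prodP (List.tabulate (λ j → powP (σ j) (Vec.lookup e j)))

⟪⟫-substP : ∀ {k r} (σ : Fin k → Poly r) h p → ⟪ h ⟫ (substP σ p) ≡ ⟪ (λ e → ⟪ h ⟫ (monomialAt σ e)) ⟫ p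
⟪⟫-substP σ h []            = refl
⟪⟫-substP σ h ((c , e) ∷ p) = ≡.trans (⟪⟫-++ h (constP c *P monomialAt σ e) (substP σ p))
  (cong₂ ℚ._+_ (⟪⟫-constP*P h c (monomialAt σ e)) (⟪⟫-substP σ h p))

module _ {k r : ℕ} (σ : Fin k → Poly r) where
  private module R = CommutativeRing (polyRing r)

  monomialAt-⊕ : ∀ a b → monomialAt σ (a ⊕ b) ≋ monomialAt σ a *P monomialAt σ b
  monomialAt-⊕ a b = begin
    monomialAt σ (a ⊕ b)
      ≡⟨ prodP-tabulate (λ j → powP (σ j) (Vec.lookup (a ⊕ b) j)) ⟩
    ΠP.sum (λ j → powP (σ j) (Vec.lookup (a ⊕ b) j))
      ≈⟨ ΠP.sum-cong-≋ (λ j → R.reflexive (cong (powP (σ j)) (VecP.lookup-zipWith ℕ._+_ j a b))) ⟩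
    ΠP.sum (λ j → powP (σ j) (Vec.lookup a j ℕ.+ Vec.lookup b j))
      ≈⟨ ΠP.sum-cong-≋ (λ j → powP-+ (σ j) (Vec.lookup a j) (Vec.lookup b j)) ⟩
    ΠP.sum (λ j → powP (σ j) (Vec.lookup a j) *P powP (σ j) (Vec.lookup b j))
      ≈⟨ ΠP.∑-distrib-+ (λ j → powP (σ j) (Vec.lookup a j)) (λ j → powP (σ j) (Vec.lookup b j)) ⟩
    ΠP.sum (λ j → powP (σ j) (Vec.lookup a j)) *P ΠP.sum (λ j → powP (σ j) (Vec.lookup b j))
      ≡⟨ cong₂ _*P_ (prodP-tabulate (λ j → powP (σ j) (Vec.lookup a j)))
                    (prodP-tabulate (λ j → powP (σ j) (Vec.lookup b j))) ⟨
    monomialAt σ a *P monomialAt σ b ∎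
    where open SetoidReasoning R.setoid

  monomialAt-0M : monomialAt σ 0M ≋ 1P
  monomialAt-0M = begin
    monomialAt σ 0M                          ≡⟨ prodP-tabulate (λ j → powP (σ j) (Vec.lookup 0M j)) ⟩
    ΠP.sum (λ j → powP (σ j) (Vec.lookup 0M j))
      ≈⟨ ΠP.sum-cong-≋ (λ j → R.reflexive (cong (powP (σ j)) (VecP.lookup-replicate j 0))) ⟩
    ΠP.sum {n = k} (λ _ → 1P)                ≈⟨ ΠP.sum-replicate-zero k ⟩
    1P                                       ∎
    where open SetoidReasoning R.setoid

  substP-cong : ∀ {p q} → p ≋ q → substP σ p ≋ substP σ q
  substP-cong {p} {q} p≋q = mk≋ λ h →
    ≡.trans (⟪⟫-substP σ h p) (≡.trans (agree p≋q _) (≡.sym (⟪⟫-substP σ h q)))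

  substP-+P : ∀ p q → substP σ (p +P q) ≋ substP σ p +P substP σ q
  substP-+P p q = mk≋ λ h → begin
    ⟪ h ⟫ (substP σ (p +P q))
      ≡⟨ ≡.trans (⟪⟫-substP σ h (p ++ q)) (⟪⟫-++ _ p q) ⟩
    ⟪ (λ e → ⟪ h ⟫ (monomialAt σ e)) ⟫ p ℚ.+ ⟪ (λ e → ⟪ h ⟫ (monomialAt σ e)) ⟫ q
      ≡⟨ cong₂ ℚ._+_ (⟪⟫-substP σ h p) (⟪⟫-substP σ h q) ⟨
    ⟪ h ⟫ (substP σ p) ℚ.+ ⟪ h ⟫ (substP σ q)
      ≡⟨ ⟪⟫-++ h (substP σ p) (substP σ q) ⟨
    ⟪ h ⟫ (substP σ p +P substP σ q)
      ∎
    where open ≡.≡-Reasoning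

  substP--P : ∀ p → substP σ (-P p) ≋ -P substP σ p
  substP--P p = mk≋ λ h → ≡.trans (⟪⟫-substP σ h (-P p)) (≡.trans (⟪⟫-neg _ p)
    (≡.trans (cong ℚ.-_ (≡.sym (⟪⟫-substP σ h p))) (≡.sym (⟪⟫-neg h (substP σ p)))))

  substP-*P : ∀ p q → substP σ (p *P q) ≋ substP σ p *P substP σ q
  substP-*P p q = mk≋ λ h → begin
    ⟪ h ⟫ (substP σ (p *P q))
      ≡⟨ ≡.trans (⟪⟫-substP σ h (p *P q)) (⟪⟫-*P _ p q) ⟩
    ⟪ (λ a → ⟪ (λ b → ⟪ h ⟫ (M (a ⊕ b))) ⟫ q) ⟫ p
      ≡⟨ ⟪⟫-cong (λ a → ⟪⟫-cong (λ b → agree (monomialAt-⊕ a b) h) q) p ⟩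
    ⟪ (λ a → ⟪ (λ b → ⟪ h ⟫ (M a *P M b)) ⟫ q) ⟫ p
      ≡⟨ ⟪⟫-cong (λ a → ⟪⟫-cong (λ b → ⟪⟫-*P h (M a) (M b)) q) p ⟩
    ⟪ (λ a → ⟪ (λ b → ⟪ (λ x → ⟪ (λ y → h (x ⊕ y)) ⟫ (M b)) ⟫ (M a)) ⟫ q) ⟫ p
      ≡⟨ ⟪⟫-cong (λ a → ⟪⟫-swap (λ x b → ⟪ (λ y → h (x ⊕ y)) ⟫ (M b)) (M a) q) p ⟨
    ⟪ (λ a → ⟪ (λ x → ⟪ (λ b → ⟪ (λ y → h (x ⊕ y)) ⟫ (M b)) ⟫ q) ⟫ (M a)) ⟫ p
      ≡⟨ ⟪⟫-cong (λ a → ⟪⟫-cong (λ x → ⟪⟫-substP σ (λ y → h (x ⊕ y)) q) (M a)) p ⟨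
    ⟪ (λ a → ⟪ (λ x → ⟪ (λ y → h (x ⊕ y)) ⟫ (substP σ q)) ⟫ (M a)) ⟫ p
      ≡⟨ ⟪⟫-substP σ _ p ⟨
    ⟪ (λ x → ⟪ (λ y → h (x ⊕ y)) ⟫ (substP σ q)) ⟫ (substP σ p)
      ≡⟨ ⟪⟫-*P h (substP σ p) (substP σ q) ⟨
    ⟪ h ⟫ (substP σ p *P substP σ q)
      ∎
    where
    open ≡.≡-Reasoning
    M = monomialAt σ

  substP-constP : ∀ c → substP σ (constP c) ≋ constP c
  substP-constP c = mk≋ λ h → begin
    ⟪ h ⟫ (substP σ (constP c))          ≡⟨ ≡.trans (⟪⟫-substP σ h (constP c)) (ℚP.+-identityʳ _) ⟩
    c ℚ.* ⟪ h ⟫ (monomialAt σ 0M)        ≡⟨ cong (c ℚ.*_) (agree monomialAt-0M h) ⟩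
    c ℚ.* (1ℚ ℚ.* h 0M ℚ.+ 0ℚ)           ≡⟨ cong (c ℚ.*_) (≡.trans (ℚP.+-identityʳ _) (ℚP.*-identityˡ _)) ⟩
    c ℚ.* h 0M                           ≡⟨ ⟪⟫-constP h c ⟨
    ⟪ h ⟫ (constP c)                     ∎
    where open ≡.≡-Reasoning

  substP-1P : substP σ 1P ≋ 1P
  substP-1P = substP-constP 1ℚ

  substP-varP : ∀ j → substP σ (varP j) ≋ σ j
  substP-varP j = begin
    substP σ (varP j)             ≈⟨ R.+-identityʳ (constP 1ℚ *P monomialAt σ uⱼ) ⟩
    constP 1ℚ *P monomialAt σ uⱼ  ≈⟨ R.*-identityˡ (monomialAt σ uⱼ) ⟩
    monomialAt σ uⱼ               ≡⟨ prodP-tabulate (λ l → powP (σ l) (Vec.lookup uⱼ l)) ⟩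
    ΠP.sum (λ l → powP (σ l) (Vec.lookup uⱼ l))
      ≈⟨ ΠP.sum-cong-≋ (λ l → R.reflexive (cong (powP (σ l)) (VecP.lookup∘tabulate _ l))) ⟩
    ΠP.sum (λ l → powP (σ l) (if does (l F.≟ j) then 1 else 0))
      ≈⟨ ΠP.sum-cong-≋ (λ l → powP-select l (does (l F.≟ j))) ⟩
    ΠP.sum (λ l → if does (l F.≟ j) then σ l else 1P)
      ≈⟨ ΠP.sum-δ σ j ⟩
    σ j                           ∎
    where
    open SetoidReasoning R.setoid
    uⱼ = Vec.tabulate (λ l → if does (l F.≟ j) then 1 else 0)
    powP-select : ∀ l b → powP (σ l) (if b then 1 else 0) ≋ (if b then σ l else 1P)
    powP-select l true  = R.*-identityʳ (σ l)
    powP-select l false = R.refl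

  substP-sumOver : ∀ {n} (T : Subset n) (f : Fin n → Poly k) → substP σ (ΣP.sumOver T f) ≋ ΣP.sumOver T (substP σ ∘ f)
  substP-sumOver = sumOver-homo (CommutativeRing.+-commutativeMonoid (polyRing k)) R.+-commutativeMonoid
    (substP σ) substP-+P R.refl

  substP-prodOver : ∀ {n} (T : Subset n) (f : Fin n → Poly k) → substP σ (ΠP.sumOver T f) ≋ ΠP.sumOver T (substP σ ∘ f)
  substP-prodOver = sumOver-homo (CommutativeRing.*-commutativeMonoid (polyRing k)) R.*-commutativeMonoid
    (substP σ) substP-*P substP-1P

  substP-phi0Sym : ∀ S → substP σ (phi0Sym S) ≋ ΣP.sumOver S σ
  substP-phi0Sym S = begin
    substP σ (phi0Sym S)               ≡⟨ cong (substP σ) (phi0Sym≡sumOver S) ⟩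
    substP σ (ΣP.sumOver S varP)       ≈⟨ substP-sumOver S varP ⟩
    ΣP.sumOver S (substP σ ∘ varP)     ≈⟨ ΣP.sumOver-cong S substP-varP ⟩
    ΣP.sumOver S σ                     ∎
    where open SetoidReasoning R.setoid

  substP-phi1Sym : ∀ S → substP σ (phi1Sym S) ≋ ΠP.sumOver S σ -P 1P
  substP-phi1Sym S = begin
    substP σ (phi1Sym S)                          ≡⟨ cong (substP σ) (phi1Sym≡prodOver-1 S) ⟩
    substP σ (ΠP.sumOver S varP -P 1P)            ≈⟨ substP-+P (ΠP.sumOver S varP) (-P 1P) ⟩
    substP σ (ΠP.sumOver S varP) +P substP σ (-P 1P)
      ≈⟨ R.+-cong (substP-prodOver S varP) (R.trans (substP--P 1P) (R.-‿cong substP-1P)) ⟩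
    ΠP.sumOver S (substP σ ∘ varP) -P 1P
      ≈⟨ R.+-congʳ (ΠP.sumOver-cong S substP-varP) ⟩
    ΠP.sumOver S σ -P 1P                          ∎
    where open SetoidReasoning R.setoid

-- Partial composition

module _ {a b : ℕ} (σ : Fin a → Poly b) (I : Fin a → Subset b) (disjoint : PairwiseDisjoint I) where
  private module R = CommutativeRing (polyRing b)

  substP-phi0Sym-⋃over : (∀ k → σ k ≋ ΣP.sumOver (I k) varP) → ∀ S → substP σ (phi0Sym S) ≋ phi0Sym (⋃over S I)
  substP-phi0Sym-⋃over σ≋I S = begin
    substP σ (phi0Sym S)                               ≈⟨ substP-phi0Sym σ S ⟩
    ΣP.sumOver S σ                                     ≈⟨ ΣP.sumOver-cong S σ≋I ⟩
    ΣP.sumOver S (λ k → ΣP.sumOver (I k) varP)         ≈⟨ ΣP.sumOver-⋃over varP S I disjoint ⟩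
    ΣP.sumOver (⋃over S I) varP                        ≡⟨ phi0Sym≡sumOver (⋃over S I) ⟨
    phi0Sym (⋃over S I)                                ∎
    where open SetoidReasoning R.setoid

  substP-phi1Sym-⋃over : (∀ k → σ k ≋ ΠP.sumOver (I k) varP) → ∀ S → substP σ (phi1Sym S) ≋ phi1Sym (⋃over S I)
  substP-phi1Sym-⋃over σ≋I S = begin
    substP σ (phi1Sym S)                               ≈⟨ substP-phi1Sym σ S ⟩
    ΠP.sumOver S σ -P 1P                               ≈⟨ R.+-congʳ (ΠP.sumOver-cong S σ≋I) ⟩
    ΠP.sumOver S (λ k → ΠP.sumOver (I k) varP) -P 1P   ≈⟨ R.+-congʳ (ΠP.sumOver-⋃over varP S I disjoint) ⟩
    ΠP.sumOver (⋃over S I) varP -P 1P                  ≡⟨ phi1Sym≡prodOver-1 (⋃over S I) ⟨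
    phi1Sym (⋃over S I)                                ∎
    where open SetoidReasoning R.setoid

module _ {m n : ℕ} (i : Fin (suc m)) where

  toℕ-gpos : ∀ j → toℕ (gpos {m} {n} i j) ≡ toℕ i ℕ.+ toℕ j
  toℕ-gpos j = FP.toℕ-fromℕ< _

  toℕ-fpos-< : ∀ k → toℕ k ℕ.< toℕ i → toℕ (fpos {m} {n} i k) ≡ toℕ k
  toℕ-fpos-< k k<i with toℕ k ℕ.<? toℕ i
  ... | yes _   = FP.toℕ-fromℕ< _
  ... | no  k≮i = contradiction k<i k≮i

  toℕ-fpos-≮ : ∀ k → ¬ (toℕ k ℕ.< toℕ i) → toℕ (fpos {m} {n} i k) ≡ toℕ k ℕ.+ n
  toℕ-fpos-≮ k k≮i with toℕ k ℕ.<? toℕ i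
  ... | yes k<i = contradiction k<i k≮i
  ... | no  _   = FP.toℕ-fromℕ< _

  private
    ≢∧≮⇒> : ∀ k → ¬ (k ≡ i) → ¬ (toℕ k ℕ.< toℕ i) → toℕ i ℕ.< toℕ k
    ≢∧≮⇒> k k≢i k≮i = ℕP.≤∧≢⇒< (ℕP.≮⇒≥ k≮i) (λ i≡k → k≢i (FP.toℕ-injective (≡.sym i≡k)))

  gpos-injective : ∀ j j′ → gpos {m} {n} i j ≡ gpos i j′ → j ≡ j′
  gpos-injective j j′ eq = FP.toℕ-injective (ℕP.+-cancelˡ-≡ (toℕ i) _ _
    (≡.trans (≡.sym (toℕ-gpos j)) (≡.trans (cong toℕ eq) (toℕ-gpos j′))))

  -- The outer slots k < i stay below the block {i, …, i + n}, the slots k > i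
  -- are shifted above it.
  fpos≢gpos : ∀ k j → ¬ (k ≡ i) → ¬ (fpos {m} {n} i k ≡ gpos i j)
  fpos≢gpos k j k≢i eq = by-cases (toℕ k ℕ.<? toℕ i)
    where
    by-cases : Dec (toℕ k ℕ.< toℕ i) → ⊥
    by-cases (yes k<i) = ℕP.<⇒≢ (ℕP.<-≤-trans k<i (ℕP.m≤m+n (toℕ i) (toℕ j)))
      (≡.trans (≡.sym (toℕ-fpos-< k k<i)) (≡.trans (cong toℕ eq) (toℕ-gpos j)))
    by-cases (no k≮i)  = ℕP.<⇒≢ (ℕP.+-mono-<-≤ (≢∧≮⇒> k k≢i k≮i) (FP.toℕ≤pred[n] j))
      (≡.trans (≡.sym (toℕ-gpos j)) (≡.trans (cong toℕ (≡.sym eq)) (toℕ-fpos-≮ k k≮i)))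

  fpos-injective : ∀ k k′ → ¬ (k ≡ i) → ¬ (k′ ≡ i) → fpos {m} {n} i k ≡ fpos i k′ → k ≡ k′
  fpos-injective k k′ k≢i k′≢i eq = by-cases (toℕ k ℕ.<? toℕ i) (toℕ k′ ℕ.<? toℕ i)
    where
    by-cases : Dec (toℕ k ℕ.< toℕ i) → Dec (toℕ k′ ℕ.< toℕ i) → k ≡ k′
    by-cases (yes k<i) (yes k′<i) = FP.toℕ-injective
      (≡.trans (≡.sym (toℕ-fpos-< k k<i)) (≡.trans (cong toℕ eq) (toℕ-fpos-< k′ k′<i)))
    by-cases (no k≮i) (no k′≮i) = FP.toℕ-injective (ℕP.+-cancelʳ-≡ n _ _
      (≡.trans (≡.sym (toℕ-fpos-≮ k k≮i)) (≡.trans (cong toℕ eq) (toℕ-fpos-≮ k′ k′≮i))))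
    by-cases (yes k<i) (no k′≮i) = contradiction
      (≡.trans (≡.sym (toℕ-fpos-< k k<i)) (≡.trans (cong toℕ eq) (toℕ-fpos-≮ k′ k′≮i)))
      (ℕP.<⇒≢ (ℕP.<-≤-trans (ℕP.<-trans k<i (≢∧≮⇒> k′ k′≢i k′≮i)) (ℕP.m≤m+n (toℕ k′) n)))
    by-cases (no k≮i) (yes k′<i) = contradiction
      (≡.trans (≡.sym (toℕ-fpos-< k′ k′<i)) (≡.trans (cong toℕ (≡.sym eq)) (toℕ-fpos-≮ k k≮i)))
      (ℕP.<⇒≢ (ℕP.<-≤-trans (ℕP.<-trans k′<i (≢∧≮⇒> k k≢i k≮i)) (ℕP.m≤m+n (toℕ k) n)))

  innerSets : Fin (suc n) → Subset (suc (m ℕ.+ n))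
  innerSets j = ⁅ gpos {m} {n} i j ⁆

  innerSets-disjoint : PairwiseDisjoint innerSets
  innerSets-disjoint j j′ p p∈ p∈′ =
    gpos-injective j j′ (≡.trans (≡.sym (lookup-⁅⁆⇒≡ _ p p∈)) (lookup-⁅⁆⇒≡ _ p p∈′))

  blockSet⇒gpos : ∀ p → Vec.lookup (blockSet {m} {n} i) p ≡ true → ∃ λ j → p ≡ gpos {m} {n} i j
  blockSet⇒gpos p p∈ with any⇒∃ (λ j → Vec.lookup (innerSets j) p) (≡.trans (≡.sym (lookup-⋃ innerSets p)) p∈)
  ... | j , p∈ⱼ = j , lookup-⁅⁆⇒≡ _ p p∈ⱼ

  outerSets-disjoint : PairwiseDisjoint (outerSets {m} {n} i)
  outerSets-disjoint k k′ p p∈ p∈′ with k F.≟ i | k′ F.≟ i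
  ... | yes refl | yes refl = refl
  ... | yes refl | no k′≢i  = let (j , p≡) = blockSet⇒gpos p p∈ in
    contradiction (≡.trans (≡.sym (lookup-⁅⁆⇒≡ _ p p∈′)) p≡) (fpos≢gpos k′ j k′≢i)
  ... | no k≢i   | yes refl = let (j , p≡) = blockSet⇒gpos p p∈′ in
    contradiction (≡.trans (≡.sym (lookup-⁅⁆⇒≡ _ p p∈)) p≡) (fpos≢gpos k j k≢i)
  ... | no k≢i   | no k′≢i  =
    fpos-injective k k′ k≢i k′≢i (≡.trans (≡.sym (lookup-⁅⁆⇒≡ _ p p∈)) (lookup-⁅⁆⇒≡ _ p p∈′))

module _ {m n : ℕ} (i : Fin (suc m)) where
  private module R = CommutativeRing (polyRing (suc (m ℕ.+ n)))

  blockSum≋sumOver-blockSet : blockSum {m} {n} i ≋ ΣP.sumOver (blockSet {m} {n} i) varP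
  blockSum≋sumOver-blockSet = R.trans (R.reflexive (sumP-tabulate (λ j → varP (gpos {m} {n} i j))))
    (ΣP.sum-≈-sumOver-⋃⁅⁆ varP (gpos i) (innerSets-disjoint i))

  blockProd≋prodOver-blockSet : blockProd {m} {n} i ≋ ΠP.sumOver (blockSet {m} {n} i) varP
  blockProd≋prodOver-blockSet = R.trans (R.reflexive (prodP-tabulate (λ j → varP (gpos {m} {n} i j))))
    (ΠP.sum-≈-sumOver-⋃⁅⁆ varP (gpos i) (innerSets-disjoint i))

  outerArgs-blockSum : ∀ k → outerArgs {m} {n} (blockSum i) i k ≋ ΣP.sumOver (outerSets {m} {n} i k) varP
  outerArgs-blockSum k with k F.≟ i
  ... | yes _ = blockSum≋sumOver-blockSet
  ... | no  _ = R.sym (ΣP.sumOver-⁅⁆ varP (fpos i k))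

  outerArgs-blockProd : ∀ k → outerArgs {m} {n} (blockProd i) i k ≋ ΠP.sumOver (outerSets {m} {n} i k) varP
  outerArgs-blockProd k with k F.≟ i
  ... | yes _ = blockProd≋prodOver-blockSet
  ... | no  _ = R.sym (ΠP.sumOver-⁅⁆ varP (fpos i k))

module _ {A : Set} {k : ℕ} (φ : A → Poly k) where
  private module R = CommutativeRing (polyRing k)

  prodP-map-++ : ∀ xs ys → prodP (List.map φ (xs ++ ys)) ≋ prodP (List.map φ xs) *P prodP (List.map φ ys)
  prodP-map-++ []       ys = R.sym (R.*-identityˡ _)
  prodP-map-++ (x ∷ xs) ys = R.trans (R.*-congˡ {φ x} (prodP-map-++ xs ys)) (R.sym (R.*-assoc (φ x) _ _))

module _ {A B : Set} {k r : ℕ} (φ : A → Poly k) (ψ : B → Poly r) (σ : Fin k → Poly r) (U : A → B)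
         (substP-φ : ∀ x → substP σ (φ x) ≋ ψ (U x)) where
  private module R = CommutativeRing (polyRing r)

  substP-prodP-map : ∀ xs → substP σ (prodP (List.map φ xs)) ≋ prodP (List.map ψ (List.map U xs))
  substP-prodP-map []       = substP-1P σ
  substP-prodP-map (x ∷ xs) =
    R.trans (substP-*P σ (φ x) (prodP (List.map φ xs))) (R.*-cong (substP-φ x) (substP-prodP-map xs))

module _ {m n : ℕ} (i : Fin (suc m)) (φ : ∀ {k} → Subset k → Poly k)
         (A : Poly (suc (m ℕ.+ n))) (σ₁ : Fin (suc m) → Poly (suc (m ℕ.+ n))) (σ₂ : Fin (suc n) → Poly (suc (m ℕ.+ n)))
         (A≋ : A ≋ φ (blockSet {m} {n} i))
         (substP-σ₁ : ∀ S → substP σ₁ (φ S) ≋ φ (⋃over S (outerSets {m} {n} i)))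
         (substP-σ₂ : ∀ S → substP σ₂ (φ S) ≋ φ (⋃over S (innerSets {m} {n} i))) where
  private module R = CommutativeRing (polyRing (suc (m ℕ.+ n)))

  extend-compFF : ∀ F G →
    extend φ (compFF {m} {n} i F G) ≈R polyR A *R substR σ₁ (extend φ F) *R substR σ₂ (extend φ G)
  extend-compFF F G = ≋⇒≈P (R.*-cong num≋ (R.sym den≋))
    where
    U = λ S → ⋃over S (outerSets {m} {n} i)
    V = λ S → ⋃over S (innerSets {m} {n} i)
    B = blockSet {m} {n} i
    num≋ : prodP (List.map φ ((B ∷ List.map U (numF F)) ++ List.map V (numF G))) ≋
           (A *P substP σ₁ (prodP (List.map φ (numF F)))) *P substP σ₂ (prodP (List.map φ (numF G)))
    num≋ = R.trans (prodP-map-++ φ (B ∷ List.map U (numF F)) (List.map V (numF G)))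
      (R.*-cong (R.*-cong (R.sym A≋) (R.sym (substP-prodP-map φ φ σ₁ U substP-σ₁ (numF F))))
                (R.sym (substP-prodP-map φ φ σ₂ V substP-σ₂ (numF G))))
    den≋ : prodP (List.map φ (List.map U (denF F) ++ List.map V (denF G))) ≋
           (1P *P substP σ₁ (prodP (List.map φ (denF F)))) *P substP σ₂ (prodP (List.map φ (denF G)))
    den≋ = R.trans (prodP-map-++ φ (List.map U (denF F)) (List.map V (denF G)))
      (R.*-cong (R.trans (R.sym (substP-prodP-map φ φ σ₁ U substP-σ₁ (denF F))) (R.sym (R.*-identityˡ _)))
                (R.sym (substP-prodP-map φ φ σ₂ V substP-σ₂ (denF G))))

phi0-preserves-∘ : ∀ {m n} (i : Fin (suc m)) F G → phi0 (compFF {m} {n} i F G) ≈R comp0 {m} {n} i (phi0 F) (phi0 G)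
phi0-preserves-∘ {m} {n} i = extend-compFF i phi0Sym (blockSum i) (outerArgs (blockSum i) i) (varP ∘ gpos i)
  (≋-trans (blockSum≋sumOver-blockSet i) (≋-reflexive (≡.sym (phi0Sym≡sumOver (blockSet i)))))
  (substP-phi0Sym-⋃over _ (outerSets i) (outerSets-disjoint i) (outerArgs-blockSum i))
  (substP-phi0Sym-⋃over _ (innerSets i) (innerSets-disjoint i) (λ j → ≋-sym (ΣP.sumOver-⁅⁆ varP (gpos i j))))

phi1-preserves-∘ : ∀ {m n} (i : Fin (suc m)) F G → phi1 (compFF {m} {n} i F G) ≈R comp1 {m} {n} i (phi1 F) (phi1 G)
phi1-preserves-∘ {m} {n} i = extend-compFF i phi1Sym (blockProd i -P 1P) (outerArgs (blockProd i) i) (varP ∘ gpos i)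
  (≋-trans (+P-cong (blockProd≋prodOver-blockSet i) (≋-reflexive refl))
           (≋-reflexive (≡.sym (phi1Sym≡prodOver-1 (blockSet i)))))
  (substP-phi1Sym-⋃over _ (outerSets i) (outerSets-disjoint i) (outerArgs-blockProd i))
  (substP-phi1Sym-⋃over _ (innerSets i) (innerSets-disjoint i) (λ j → ≋-sym (ΠP.sumOver-⁅⁆ varP (gpos i j))))

-- Symmetric group action, units and well-definedness

module _ {n : ℕ} (π : Permutation′ n) where
  private module R = CommutativeRing (polyRing n)

  permuteVars : Fin n → Poly n
  permuteVars j = varP (π ⟨$⟩ʳ j)

  substP-permuteVars-phi0Sym : ∀ S → substP permuteVars (phi0Sym S) ≋ phi0Sym (imageSet π S)
  substP-permuteVars-phi0Sym S = R.trans (substP-phi0Sym permuteVars S) (R.sym (R.trans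
    (R.reflexive (phi0Sym≡sumOver (imageSet π S))) (ΣP.sumOver-imageSet π S varP)))

  substP-permuteVars-phi1Sym : ∀ S → substP permuteVars (phi1Sym S) ≋ phi1Sym (imageSet π S)
  substP-permuteVars-phi1Sym S = R.trans (substP-phi1Sym permuteVars S) (R.sym (R.trans
    (R.reflexive (phi1Sym≡prodOver-1 (imageSet π S))) (R.+-congʳ (ΠP.sumOver-imageSet π S varP))))

  extend-equivariant : (φ : ∀ {k} → Subset k → Poly k) → (∀ S → substP permuteVars (φ S) ≋ φ (imageSet π S)) →
    ∀ F → extend φ (actFF π F) ≈R actR π (extend φ F)
  extend-equivariant φ substP-φ F = ≋⇒≈P (R.*-cong
    (R.sym (substP-prodP-map φ φ permuteVars (imageSet π) substP-φ (numF F)))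
    (substP-prodP-map φ φ permuteVars (imageSet π) substP-φ (denF F)))

phi0-preserves-unit : phi0 unitFF ≈R unit0
phi0-preserves-unit = ≋⇒≈P (R.*-congˡ {1P} (R.sym (R.trans (R.*-identityʳ (phi0Sym {1} ⁅ zero ⁆))
  (R.trans (R.reflexive (phi0Sym≡sumOver ⁅ zero ⁆)) (ΣP.sumOver-⁅⁆ varP zero)))))
  where module R = CommutativeRing (polyRing 1)

phi1-preserves-unit : phi1 unitFF ≈R unit1
phi1-preserves-unit = ≋⇒≈P (R.*-congˡ {1P} (R.sym (R.trans (R.*-identityʳ (phi1Sym {1} ⁅ zero ⁆))
  (R.trans (R.reflexive (phi1Sym≡prodOver-1 ⁅ zero ⁆)) (R.+-congʳ (ΠP.sumOver-⁅⁆ varP zero))))))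
  where module R = CommutativeRing (polyRing 1)

module _ {n : ℕ} where

  count-here : ∀ (S : Subset n) Ts → count S (S ∷ Ts) ≡ suc (count S Ts)
  count-here S Ts with ≡-dec B._≟_ S S
  ... | yes _   = refl
  ... | no  S≢S = contradiction refl S≢S

  count-there : ∀ (S T : Subset n) Ts → ¬ (T ≡ S) → count S (T ∷ Ts) ≡ count S Ts
  count-there S T Ts T≢S with ≡-dec B._≟_ T S
  ... | yes T≡S = contradiction T≡S T≢S
  ... | no  _   = refl

  count-++ : ∀ (S : Subset n) xs ys → count S (xs ++ ys) ≡ count S xs ℕ.+ count S ys
  count-++ S []       ys = refl
  count-++ S (T ∷ xs) ys with ≡-dec B._≟_ T S
  ... | yes _ = cong suc (count-++ S xs ys)
  ... | no  _ = count-++ S xs ys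

  remove : Subset n → List (Subset n) → List (Subset n)
  remove x []       = []
  remove x (y ∷ ys) with ≡-dec B._≟_ y x
  ... | yes _ = ys
  ... | no  _ = y ∷ remove x ys

  count-remove-same : ∀ x ys → ¬ (count x ys ≡ 0) → count x ys ≡ suc (count x (remove x ys))
  count-remove-same x []       x∉ys = contradiction refl x∉ys
  count-remove-same x (y ∷ ys) x∈ys with ≡-dec B._≟_ y x
  ... | yes refl = refl
  ... | no  y≢x  = ≡.trans (count-remove-same x ys x∈ys) (cong suc (≡.sym (count-there x y (remove x ys) y≢x)))

  count-remove-other : ∀ S x ys → ¬ (S ≡ x) → count S (remove x ys) ≡ count S ys
  count-remove-other S x []       _   = refl
  count-remove-other S x (y ∷ ys) S≢x with ≡-dec B._≟_ y x
  ... | yes refl = ≡.sym (count-there S y ys (λ y≡S → S≢x (≡.sym y≡S)))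
  ... | no  _ with ≡-dec B._≟_ y S
  ...   | yes _ = cong suc (count-remove-other S x ys S≢x)
  ...   | no  _ = count-remove-other S x ys S≢x

  module _ (φ : Subset n → Poly n) where
    private
      module R = CommutativeRing (polyRing n)
      open CommutativeSemigroupProperties R.*-commutativeSemigroup using (x∙yz≈y∙xz)

    prodP-map-remove : ∀ x ys → ¬ (count x ys ≡ 0) → prodP (List.map φ ys) ≋ φ x *P prodP (List.map φ (remove x ys))
    prodP-map-remove x []       x∉ys = contradiction refl x∉ys
    prodP-map-remove x (y ∷ ys) x∈ys with ≡-dec B._≟_ y x
    ... | yes refl = R.refl
    ... | no  _    = R.trans (R.*-congˡ {φ y} (prodP-map-remove x ys x∈ys)) (x∙yz≈y∙xz (φ y) (φ x) _)

    prodP-map-count-cong : ∀ xs ys → (∀ S → count S xs ≡ count S ys) → prodP (List.map φ xs) ≋ prodP (List.map φ ys)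
    prodP-map-count-cong []       []       _ = R.refl
    prodP-map-count-cong []       (y ∷ ys) same = contradiction (≡.trans (same y) (count-here y ys)) (λ ())
    prodP-map-count-cong (x ∷ xs) ys       same =
      R.trans (R.*-congˡ {φ x} (prodP-map-count-cong xs (remove x ys) same′)) (R.sym (prodP-map-remove x ys x∈ys))
      where
      x∈ys : ¬ (count x ys ≡ 0)
      x∈ys x∉ys = contradiction (≡.trans (≡.sym (count-here x xs)) (≡.trans (same x) x∉ys)) (λ ())
      same′ : ∀ S → count S xs ≡ count S (remove x ys)
      same′ S with ≡-dec B._≟_ S x
      ... | yes refl = ℕP.suc-injective (≡.trans (≡.sym (count-here S xs)) (≡.trans (same S) (count-remove-same S ys x∈ys)))
      ... | no  S≢x  = ≡.trans (≡.sym (count-there S x xs (λ x≡S → S≢x (≡.sym x≡S))))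
                         (≡.trans (same S) (≡.sym (count-remove-other S x ys S≢x)))

extend-respects : (φ : ∀ {k} → Subset k → Poly k) → ∀ {n} (F G : FF n) → F ≈F G → extend φ F ≈R extend φ G
extend-respects φ F G F≈G = ≋⇒≈P (≋-trans (≋-sym (prodP-map-++ φ (numF F) (denF G)))
  (≋-trans (prodP-map-count-cong φ (numF F ++ denF G) (numF G ++ denF F) same) (prodP-map-++ φ (numF G) (denF F))))
  where
  same : ∀ S → count S (numF F ++ denF G) ≡ count S (numF G ++ denF F)
  same S = ≡.trans (count-++ S (numF F) (denF G)) (≡.trans (F≈G S) (≡.sym (count-++ S (numF G) (denF F))))

-- Order of vanishing at t = 0

⟪⟫-*P-multiplicative : ∀ {k} (h : Mono k → ℚ) → (∀ a b → h (a ⊕ b) ≡ h a ℚ.* h b) →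
  ∀ p q → ⟪ h ⟫ (p *P q) ≡ ⟪ h ⟫ p ℚ.* ⟪ h ⟫ q
⟪⟫-*P-multiplicative h h-⊕ p q = begin
  ⟪ h ⟫ (p *P q)                                ≡⟨ ⟪⟫-*P h p q ⟩
  ⟪ (λ e → ⟪ (λ e′ → h (e ⊕ e′)) ⟫ q) ⟫ p       ≡⟨ ⟪⟫-cong (λ e → ≡.trans (⟪⟫-cong (h-⊕ e) q) (⟪⟫-scale (h e) h q)) p ⟩
  ⟪ (λ e → h e ℚ.* ⟪ h ⟫ q) ⟫ p                 ≡⟨ ⟪⟫-cong (λ e → ℚP.*-comm (h e) (⟪ h ⟫ q)) p ⟩
  ⟪ (λ e → ⟪ h ⟫ q ℚ.* h e) ⟫ p                 ≡⟨ ⟪⟫-scale (⟪ h ⟫ q) h p ⟩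
  ⟪ h ⟫ q ℚ.* ⟪ h ⟫ p                           ≡⟨ ℚP.*-comm (⟪ h ⟫ q) (⟪ h ⟫ p) ⟩
  ⟪ h ⟫ p ℚ.* ⟪ h ⟫ q                           ∎
  where open ≡.≡-Reasoning

t : Poly 1
t = varP zero

monomial₀ : Mono 1 → ℚ
monomial₀ (zero  ∷ []) = 1ℚ
monomial₀ (suc _ ∷ []) = 0ℚ

ev₀ : Poly 1 → ℚ
ev₀ = ⟪ monomial₀ ⟫

ev₀-cong : ∀ {p q} → p ≋ q → ev₀ p ≡ ev₀ q
ev₀-cong p≋q = agree p≋q monomial₀

ev₀-+P : ∀ p q → ev₀ (p +P q) ≡ ev₀ p ℚ.+ ev₀ q
ev₀-+P = ⟪⟫-++ monomial₀

ev₀--P : ∀ p → ev₀ (-P p) ≡ ℚ.- ev₀ p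
ev₀--P = ⟪⟫-neg monomial₀

ev₀-*P : ∀ p q → ev₀ (p *P q) ≡ ev₀ p ℚ.* ev₀ q
ev₀-*P = ⟪⟫-*P-multiplicative monomial₀ λ
  { (zero  ∷ []) (zero  ∷ []) → refl
  ; (zero  ∷ []) (suc _ ∷ []) → refl
  ; (suc _ ∷ []) (e ∷ [])     → ≡.sym (ℚP.*-zeroˡ (monomial₀ (e ∷ []))) }

ev₀-constP : ∀ c → ev₀ (constP c) ≡ c
ev₀-constP c = ≡.trans (⟪⟫-constP monomial₀ c) (ℚP.*-identityʳ c)

t*P-cancelˡ : ∀ {p q} → t *P p ≋ t *P q → p ≋ q
t*P-cancelˡ {p} {q} tp≋tq = ≈P⇒≋ λ { (d ∷ []) →
  ≡.trans (coeff-shift p d) (≡.trans (agree tp≋tq _) (≡.sym (coeff-shift q d))) }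
  where
  δ-suc : ∀ d e → δ (suc d ∷ []) (suc e ∷ []) ≡ δ (d ∷ []) (e ∷ [])
  δ-suc d e with ≡-dec ℕ._≟_ (suc e ∷ []) (suc d ∷ []) | ≡-dec ℕ._≟_ (e ∷ []) (d ∷ [])
  ... | yes _ | yes _ = refl
  ... | no  _ | no  _ = refl
  ... | yes refl | no e≢d = contradiction refl e≢d
  ... | no se≢sd | yes refl = contradiction refl se≢sd
  coeff-shift : ∀ p d → coeff p (d ∷ []) ≡ ⟪ δ (suc d ∷ []) ⟫ (t *P p)
  coeff-shift p d = ≡.trans (coeff≡⟪δ⟫ p (d ∷ [])) (≡.sym (≡.trans (⟪⟫-*P _ t p)
    (≡.trans (≡.trans (ℚP.+-identityʳ _) (ℚP.*-identityˡ _)) (⟪⟫-cong (λ { (e ∷ []) → δ-suc d e }) p))))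

t^-order-unique : ∀ a b {U V} → powP t a *P U ≋ powP t b *P V → ¬ (ev₀ U ≡ 0ℚ) → ¬ (ev₀ V ≡ 0ℚ) → a ≡ b
t^-order-unique zero    zero    _ _ _ = refl
t^-order-unique (suc a) (suc b) {U} {V} eq U₀≢0 V₀≢0 = cong suc (t^-order-unique a b (t*P-cancelˡ
  (R₁.trans (R₁.sym (R₁.*-assoc t (powP t a) U)) (R₁.trans eq (R₁.*-assoc t (powP t b) V)))) U₀≢0 V₀≢0)
t^-order-unique zero    (suc b) {U} {V} eq U₀≢0 _ = contradiction (begin
  ev₀ U
    ≡⟨ ≡.trans (ev₀-*P 1P U) (ℚP.*-identityˡ (ev₀ U)) ⟨
  ev₀ (1P *P U)
    ≡⟨ ev₀-cong eq ⟩
  ev₀ (t *P powP t b *P V)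
    ≡⟨ ≡.trans (ev₀-*P (t *P powP t b) V) (cong (ℚ._* ev₀ V) (ev₀-*P t (powP t b))) ⟩
  0ℚ ℚ.* ev₀ (powP t b) ℚ.* ev₀ V
    ≡⟨ ≡.trans (cong (ℚ._* ev₀ V) (ℚP.*-zeroˡ (ev₀ (powP t b)))) (ℚP.*-zeroˡ (ev₀ V)) ⟩
  0ℚ ∎) U₀≢0
  where open ≡.≡-Reasoning
t^-order-unique (suc a) zero eq U₀≢0 V₀≢0 = ≡.sym (t^-order-unique zero (suc a) (R₁.sym eq) V₀≢0 U₀≢0)

module _ {n : ℕ} (ψ : Subset n → Poly 1) (S : Subset n) (ψS≋t : ψ S ≋ t)
         (ψT₀≢0 : ∀ T → Nonempty T → ¬ (T ≡ S) → ¬ (ev₀ (ψ T) ≡ 0ℚ)) where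

  prodP-map-factor : ∀ xs → All Nonempty xs →
    Σ (Poly 1) λ U → (prodP (List.map ψ xs) ≋ powP t (count S xs) *P U) × ¬ (ev₀ U ≡ 0ℚ)
  prodP-map-factor []       []         = 1P , R₁.sym (R₁.*-identityˡ 1P) , ℚP.1≢0
  prodP-map-factor (x ∷ xs) (x≠∅ ∷ xs≠∅) with prodP-map-factor xs xs≠∅
  ... | U , ψxs≋ , U₀≢0 with ≡-dec B._≟_ x S
  ...   | yes refl = U , R₁.trans (R₁.*-cong ψS≋t ψxs≋) (R₁.sym (R₁.*-assoc t (powP t (count S xs)) U)) , U₀≢0
  ...   | no  x≢S  = ψ x *P U , R₁.trans (R₁.*-congˡ {ψ x} ψxs≋) (x∙yz≈y∙xz (ψ x) (powP t (count S xs)) U)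
                   , λ ψxU₀≡0 → *-≢0 (ψT₀≢0 x x≠∅ x≢S) U₀≢0 (≡.trans (≡.sym (ev₀-*P (ψ x) U)) ψxU₀≡0)
    where open CommutativeSemigroupProperties R₁.*-commutativeSemigroup using (x∙yz≈y∙xz)

  count-≡-from-prodP : ∀ xs ys → All Nonempty xs → All Nonempty ys →
    prodP (List.map ψ xs) ≋ prodP (List.map ψ ys) → count S xs ≡ count S ys
  count-≡-from-prodP xs ys xs≠∅ ys≠∅ eq with prodP-map-factor xs xs≠∅ | prodP-map-factor ys ys≠∅
  ... | U , ψxs≋ , U₀≢0 | V , ψys≋ , V₀≢0 =
    t^-order-unique (count S xs) (count S ys) (R₁.trans (R₁.sym ψxs≋) (R₁.trans eq ψys≋)) U₀≢0 V₀≢0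

ev₀-sumOver : ∀ {n} (T : Subset n) (f : Fin n → Poly 1) → ev₀ (ΣP.sumOver T f) ≡ Σℚ.sumOver T (ev₀ ∘ f)
ev₀-sumOver = sumOver-homo R₁.+-commutativeMonoid ℚP.+-0-commutativeMonoid ev₀ ev₀-+P refl

ev₀-prodOver : ∀ {n} (T : Subset n) (f : Fin n → Poly 1) → ev₀ (ΠP.sumOver T f) ≡ Πℚ.sumOver T (ev₀ ∘ f)
ev₀-prodOver = sumOver-homo R₁.*-commutativeMonoid ℚP.*-1-commutativeMonoid ev₀ ev₀-*P refl

module _ {n : ℕ} (τ : Fin n → Poly 1) where

  ev₀-substP-phi0Sym : ∀ T → ev₀ (substP τ (phi0Sym T)) ≡ Σℚ.sumOver T (ev₀ ∘ τ)
  ev₀-substP-phi0Sym T = ≡.trans (ev₀-cong (substP-phi0Sym τ T)) (ev₀-sumOver T τ)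

  ev₀-substP-phi1Sym : ∀ T → ev₀ (substP τ (phi1Sym T)) ≡ Πℚ.sumOver T (ev₀ ∘ τ) ℚ.- 1ℚ
  ev₀-substP-phi1Sym T = ≡.trans (ev₀-cong (substP-phi1Sym τ T))
    (≡.trans (ev₀-+P (ΠP.sumOver T τ) (-P 1P)) (cong₂ ℚ._+_ (ev₀-prodOver T τ) (ev₀--P 1P)))

  module _ (φ : Subset n → Poly n) (φ₀≢0 : ∀ T → Nonempty T → ¬ (ev₀ (substP τ (φ T)) ≡ 0ℚ)) where

    ev₀-substP-prodP-map≢0 : ∀ xs → All Nonempty xs → ¬ (ev₀ (substP τ (prodP (List.map φ xs))) ≡ 0ℚ)
    ev₀-substP-prodP-map≢0 []       []           = ≡.subst (λ x → ¬ (x ≡ 0ℚ)) (≡.sym (ev₀-cong (substP-1P τ))) ℚP.1≢0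
    ev₀-substP-prodP-map≢0 (x ∷ xs) (x≠∅ ∷ xs≠∅) eq₀ = *-≢0 (φ₀≢0 x x≠∅) (ev₀-substP-prodP-map≢0 xs xs≠∅) (begin
      ev₀ (substP τ (φ x)) ℚ.* ev₀ (substP τ (prodP (List.map φ xs)))
        ≡⟨ ev₀-*P (substP τ (φ x)) (substP τ (prodP (List.map φ xs))) ⟨
      ev₀ (substP τ (φ x) *P substP τ (prodP (List.map φ xs)))
        ≡⟨ ev₀-cong (substP-*P τ (φ x) _) ⟨
      ev₀ (substP τ (prodP (List.map φ (x ∷ xs))))
        ≡⟨ eq₀ ⟩
      0ℚ ∎)
      where open ≡.≡-Reasoning

NonvanishingPoint : (∀ {k} → Subset k → Poly k) → Set
NonvanishingPoint φ = ∀ {n} → Σ (Fin n → Poly 1) λ τ → ∀ T → Nonempty T → ¬ (ev₀ (substP τ (φ T)) ≡ 0ℚ)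

SeparatingLines : (∀ {k} → Subset k → Poly k) → Set
SeparatingLines φ = ∀ {n} (S : Subset n) → Nonempty S → Σ (Fin n → Poly 1) λ τ →
  substP τ (φ S) ≋ t × (∀ T → Nonempty T → ¬ (T ≡ S) → ¬ (ev₀ (substP τ (φ T)) ≡ 0ℚ))

module _ (φ : ∀ {k} → Subset k → Poly k) where

  extend-valid : NonvanishingPoint φ → ∀ {n} (F : FF n) → WF F → ValidR (extend φ F)
  extend-valid point {n} F (_ , denF≠∅) den≈0 with point {n}
  ... | τ , φ₀≢0 = ev₀-substP-prodP-map≢0 τ φ φ₀≢0 (denF F) denF≠∅
    (ev₀-cong (substP-cong τ (≈P⇒≋ {p = den (extend φ F)} {q = 0P} den≈0)))

  extend-injective : SeparatingLines φ → ∀ {n} (F G : FF n) → WF F → WF G → extend φ F ≈R extend φ G → F ≈F G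
  extend-injective lines {n} F G (numF≠∅ , denF≠∅) (numG≠∅ , denG≠∅) eq S with nonempty? S
  ... | no  S≡∅ = cong₂ ℕ._+_ (≡.trans (count-∅ (numF F) numF≠∅) (≡.sym (count-∅ (numF G) numG≠∅)))
                              (≡.trans (count-∅ (denF G) denG≠∅) (≡.sym (count-∅ (denF F) denF≠∅)))
    where
    count-∅ : ∀ xs → All Nonempty xs → count S xs ≡ 0
    count-∅ []       []           = refl
    count-∅ (x ∷ xs) (x≠∅ ∷ xs≠∅) with ≡-dec B._≟_ x S
    ... | yes refl = contradiction x≠∅ S≡∅
    ... | no  _    = count-∅ xs xs≠∅
  ... | yes S≠∅ with lines S S≠∅
  ...   | τ , τS≋t , τT₀≢0 = begin
    count S (numF F) ℕ.+ count S (denF G)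
      ≡⟨ count-++ S (numF F) (denF G) ⟨
    count S (numF F ++ denF G)
      ≡⟨ count-≡-from-prodP ψ S τS≋t τT₀≢0 _ _ (++⁺ numF≠∅ denG≠∅) (++⁺ numG≠∅ denF≠∅) ψ-eq ⟩
    count S (numF G ++ denF F)
      ≡⟨ count-++ S (numF G) (denF F) ⟩
    count S (numF G) ℕ.+ count S (denF F) ∎
    where
    open ≡.≡-Reasoning
    ψ : Subset n → Poly 1
    ψ T = substP τ (φ T)
    substP-τ : ∀ xs → substP τ (prodP (List.map φ xs)) ≋ prodP (List.map ψ xs)
    substP-τ xs = R₁.trans (substP-prodP-map φ ψ τ (λ T → T) (λ _ → R₁.refl) xs)
      (R₁.reflexive (cong (prodP ∘ List.map ψ) (ListP.map-id xs)))
    ψ-eq : prodP (List.map ψ (numF F ++ denF G)) ≋ prodP (List.map ψ (numF G ++ denF F))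
    ψ-eq = R₁.trans (R₁.sym (substP-τ (numF F ++ denF G))) (R₁.trans (substP-cong τ (≋-trans
      (prodP-map-++ φ (numF F) (denF G)) (≋-trans (≈P⇒≋ eq) (≋-sym (prodP-map-++ φ (numF G) (denF F))))))
      (substP-τ (numF G ++ denF F)))

-- Nonvanishing points and separating lines

module Σℕ = FinSum ℕP.+-0-commutativeMonoid
module Πℕ = FinSum ℕP.*-1-commutativeMonoid

ι : ℕ → ℚ
ι n = n ×ℚ 1ℚ

ι-+ : ∀ a b → ι (a ℕ.+ b) ≡ ι a ℚ.+ ι b
ι-+ a b = ×-homo-+ 1ℚ a b

ι-* : ∀ a b → ι (a ℕ.* b) ≡ ι a ℚ.* ι b
ι-* = ×1-homo-*

ι-1 : ι 1 ≡ 1ℚ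
ι-1 = ×-homo-1 1ℚ

ι-nonNegative : ∀ n → 0ℚ ℚ.≤ ι n
ι-nonNegative zero    = ℚP.≤-refl
ι-nonNegative (suc n) = ℚP.+-mono-≤ (ℚP.nonNegative⁻¹ 1ℚ) (ι-nonNegative n)

ι-suc-positive : ∀ n → 0ℚ ℚ.< ι (suc n)
ι-suc-positive n = ℚP.+-mono-<-≤ (ℚP.positive⁻¹ 1ℚ) (ι-nonNegative n)

ι-injective : ∀ a b → ι a ≡ ι b → a ≡ b
ι-injective zero    zero    _   = refl
ι-injective zero    (suc b) 0≡b = contradiction 0≡b (ℚP.<⇒≢ (ι-suc-positive b))
ι-injective (suc a) zero    a≡0 = contradiction (≡.sym a≡0) (ℚP.<⇒≢ (ι-suc-positive a))
ι-injective (suc a) (suc b) eq  = cong suc (ι-injective a b (ℚGroup.∙-cancelˡ 1ℚ (ι a) (ι b) eq))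

binary : ∀ {n} → Subset n → ℕ
binary T = Σℕ.sumOver T (λ j → 2 ℕ.^ toℕ j)

binary-∷ : ∀ {n} b (T : Subset n) → binary (b ∷ T) ≡ (if b then 1 else 0) ℕ.+ 2 ℕ.* binary T
binary-∷ b T = cong ((if b then 1 else 0) ℕ.+_) (≡.sym (sumOver-homo ℕP.+-0-commutativeMonoid ℕP.+-0-commutativeMonoid
  (2 ℕ.*_) (ℕP.*-distribˡ-+ 2) (ℕP.*-zeroʳ 2) T (λ j → 2 ℕ.^ toℕ j)))

binary-injective : ∀ {n} (T T′ : Subset n) → binary T ≡ binary T′ → T ≡ T′
binary-injective []      []        _  = refl
binary-injective (b ∷ T) (b′ ∷ T′) eq with b | b′ | ≡.trans (≡.sym (binary-∷ b T)) (≡.trans eq (binary-∷ b′ T′))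
... | true  | true  | eq′ = cong (true ∷_) (binary-injective T T′ (ℕP.*-cancelˡ-≡ _ _ 2 (ℕP.suc-injective eq′)))
... | false | false | eq′ = cong (false ∷_) (binary-injective T T′ (ℕP.*-cancelˡ-≡ _ _ 2 eq′))
... | true  | false | eq′ = contradiction (≡.sym eq′) (ℕP.even≢odd (binary T′) (binary T))
... | false | true  | eq′ = contradiction eq′ (ℕP.even≢odd (binary T) (binary T′))

binary≢0 : ∀ {n} (T : Subset n) → Nonempty T → ¬ (binary T ≡ 0)
binary≢0 {n} T (x , x∈T) binaryT≡0 = ∉⊥ (≡.subst (x ∈_) (binary-injective T emptySet
  (≡.trans binaryT≡0 (≡.sym (Σℕ.sumOver-∅ {n} (λ j → 2 ℕ.^ toℕ j))))) x∈T)

2^-injective : ∀ a b → 2 ℕ.^ a ≡ 2 ℕ.^ b → a ≡ b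
2^-injective a b eq = ≡.trans (≡.sym (⌊log₂[2^n]⌋≡n a)) (≡.trans (cong ⌊log₂_⌋ eq) (⌊log₂[2^n]⌋≡n b))

2^e≡1⇒e≡0 : ∀ {e} → 2 ℕ.^ e ≡ 1 → e ≡ 0
2^e≡1⇒e≡0 {e} eq with ℕP.m^n≡1⇒n≡0∨m≡1 2 e eq
... | inj₁ e≡0 = e≡0

2^binary : ∀ {n} (T : Subset n) → Πℕ.sumOver T (λ j → 2 ℕ.^ 2 ℕ.^ toℕ j) ≡ 2 ℕ.^ binary T
2^binary T = ≡.sym (sumOver-homo ℕP.+-0-commutativeMonoid ℕP.*-1-commutativeMonoid
  (2 ℕ.^_) (ℕP.^-distribˡ-+-* 2) refl T (λ j → 2 ℕ.^ toℕ j))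

ι-sumOver : ∀ {n} (T : Subset n) (f : Fin n → ℕ) → ι (Σℕ.sumOver T f) ≡ Σℚ.sumOver T (ι ∘ f)
ι-sumOver = sumOver-homo ℕP.+-0-commutativeMonoid ℚP.+-0-commutativeMonoid ι ι-+ refl

ι-prodOver : ∀ {n} (T : Subset n) (f : Fin n → ℕ) → ι (Πℕ.sumOver T f) ≡ Πℚ.sumOver T (ι ∘ f)
ι-prodOver = sumOver-homo ℕP.*-1-commutativeMonoid ℚP.*-1-commutativeMonoid ι ι-* ι-1

phi0Sym-nonvanishingPoint : NonvanishingPoint phi0Sym
phi0Sym-nonvanishingPoint = τ , λ T T≠∅ eq₀ → binary≢0 T T≠∅ (ι-injective (binary T) 0 (begin
  ι (binary T)                                 ≡⟨ ι-sumOver T (λ j → 2 ℕ.^ toℕ j) ⟩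
  Σℚ.sumOver T (λ j → ι (2 ℕ.^ toℕ j))         ≡⟨ Σℚ.sumOver-cong T (λ j → ev₀-constP (ι (2 ℕ.^ toℕ j))) ⟨
  Σℚ.sumOver T (ev₀ ∘ τ)                       ≡⟨ ev₀-substP-phi0Sym τ T ⟨
  ev₀ (substP τ (phi0Sym T))                   ≡⟨ eq₀ ⟩
  0ℚ                                           ∎))
  where
  open ≡.≡-Reasoning
  τ = λ j → constP (ι (2 ℕ.^ toℕ j))

phi1Sym-nonvanishingPoint : NonvanishingPoint phi1Sym
phi1Sym-nonvanishingPoint = τ , λ T T≠∅ eq₀ → binary≢0 T T≠∅ (2^e≡1⇒e≡0 (ι-injective _ 1 (begin
  ι (2 ℕ.^ binary T)                                 ≡⟨ cong ι (2^binary T) ⟨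
  ι (Πℕ.sumOver T (λ j → 2 ℕ.^ 2 ℕ.^ toℕ j))         ≡⟨ ι-prodOver T (λ j → 2 ℕ.^ 2 ℕ.^ toℕ j) ⟩
  Πℚ.sumOver T (λ j → ι (2 ℕ.^ 2 ℕ.^ toℕ j))         ≡⟨ Πℚ.sumOver-cong T (λ j → ev₀-constP (ι (2 ℕ.^ 2 ℕ.^ toℕ j))) ⟨
  Πℚ.sumOver T (ev₀ ∘ τ)                             ≡⟨ x-y≡0⇒x≡y _ 1ℚ (≡.trans (≡.sym (ev₀-substP-phi1Sym τ T)) eq₀) ⟩
  1ℚ                                                 ≡⟨ ι-1 ⟨
  ι 1                                                ∎)))
  where
  open ≡.≡-Reasoning
  τ = λ j → constP (ι (2 ℕ.^ 2 ℕ.^ toℕ j))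

module _ {n : ℕ} (s : Fin n) (a : Fin n → ℚ) (X : Poly 1) where

  shiftedAt : Fin n → Poly 1
  shiftedAt j = constP (a j) +P (if does (j F.≟ s) then X else 0P)

  scaledAt : Fin n → Poly 1
  scaledAt j = constP (a j) *P (if does (j F.≟ s) then X else 1P)

  substP-shiftedAt-phi0Sym : ∀ T →
    substP shiftedAt (phi0Sym T) ≋ constP (Σℚ.sumOver T a) +P (if Vec.lookup T s then X else 0P)
  substP-shiftedAt-phi0Sym T = R₁.trans (substP-phi0Sym shiftedAt T) (R₁.trans
    (ΣP.sumOver-∙ T (constP ∘ a) (λ j → if does (j F.≟ s) then X else 0P))
    (R₁.+-cong (constP-sumOver T a) (ΣP.sumOver-δ T s X)))

  substP-scaledAt-phi1Sym : ∀ T →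
    substP scaledAt (phi1Sym T) ≋ constP (Πℚ.sumOver T a) *P (if Vec.lookup T s then X else 1P) -P 1P
  substP-scaledAt-phi1Sym T = R₁.trans (substP-phi1Sym scaledAt T) (R₁.+-congʳ (R₁.trans
    (ΠP.sumOver-∙ T (constP ∘ a) (λ j → if does (j F.≟ s) then X else 1P))
    (R₁.*-cong (constP-prodOver T a) (ΠP.sumOver-δ T s X))))

  ev₀-substP-shiftedAt-phi0Sym : ev₀ X ≡ 0ℚ → ∀ T → ev₀ (substP shiftedAt (phi0Sym T)) ≡ Σℚ.sumOver T a
  ev₀-substP-shiftedAt-phi0Sym X₀≡0 T = ≡.trans (ev₀-substP-phi0Sym shiftedAt T) (Σℚ.sumOver-cong T ev₀-shiftedAt)
    where
    ev₀-select : ∀ b → ev₀ (if b then X else 0P) ≡ 0ℚ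
    ev₀-select true  = X₀≡0
    ev₀-select false = refl
    ev₀-shiftedAt : ∀ j → ev₀ (shiftedAt j) ≡ a j
    ev₀-shiftedAt j = ≡.trans (ev₀-+P (constP (a j)) (if does (j F.≟ s) then X else 0P))
      (≡.trans (cong₂ ℚ._+_ (ev₀-constP (a j)) (ev₀-select (does (j F.≟ s)))) (ℚP.+-identityʳ (a j)))

  ev₀-substP-scaledAt-phi1Sym : ev₀ X ≡ 1ℚ → ∀ T → ev₀ (substP scaledAt (phi1Sym T)) ≡ Πℚ.sumOver T a ℚ.- 1ℚ
  ev₀-substP-scaledAt-phi1Sym X₀≡1 T =
    ≡.trans (ev₀-substP-phi1Sym scaledAt T) (cong (ℚ._- 1ℚ) (Πℚ.sumOver-cong T ev₀-scaledAt))
    where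
    ev₀-select : ∀ b → ev₀ (if b then X else 1P) ≡ 1ℚ
    ev₀-select true  = X₀≡1
    ev₀-select false = refl
    ev₀-scaledAt : ∀ j → ev₀ (scaledAt j) ≡ a j
    ev₀-scaledAt j = ≡.trans (ev₀-*P (constP (a j)) (if does (j F.≟ s) then X else 1P))
      (≡.trans (cong₂ ℚ._*_ (ev₀-constP (a j)) (ev₀-select (does (j F.≟ s)))) (ℚP.*-identityʳ (a j)))

module _ {n : ℕ} (S : Subset n) (s : Fin n) where

  -- u_j ↦ 2^j, except u_s ↦ 2^s − binary S + t; this sends φ⁰ T to
  -- binary T − binary S + t when s ∈ T, and to binary T otherwise.
  a⁰ : Fin n → ℚ
  a⁰ j = ι (2 ℕ.^ toℕ j) ℚ.+ (if does (j F.≟ s) then ℚ.- ι (binary S) else 0ℚ)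

  line⁰ : Fin n → Poly 1
  line⁰ = shiftedAt s a⁰ t

  sumOver-a⁰ : ∀ T → Σℚ.sumOver T a⁰ ≡ ι (binary T) ℚ.+ (if Vec.lookup T s then ℚ.- ι (binary S) else 0ℚ)
  sumOver-a⁰ T = ≡.trans
    (Σℚ.sumOver-∙ T (λ j → ι (2 ℕ.^ toℕ j)) (λ j → if does (j F.≟ s) then ℚ.- ι (binary S) else 0ℚ))
    (cong₂ ℚ._+_ (≡.sym (ι-sumOver T (λ j → 2 ℕ.^ toℕ j))) (Σℚ.sumOver-δ T s (ℚ.- ι (binary S))))

  line⁰-through : Vec.lookup S s ≡ true → substP line⁰ (phi0Sym S) ≋ t
  line⁰-through s∈S = begin
    substP line⁰ (phi0Sym S)
      ≈⟨ substP-shiftedAt-phi0Sym s a⁰ t S ⟩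
    constP (Σℚ.sumOver S a⁰) +P (if Vec.lookup S s then t else 0P)
      ≡⟨ cong₂ (λ a X → constP a +P X) (≡.trans (sumOver-a⁰ S) (cong select s∈S)) (cong (if_then t else 0P) s∈S) ⟩
    constP (ι (binary S) ℚ.- ι (binary S)) +P t
      ≈⟨ R₁.+-congʳ (≋-trans (≋-reflexive (cong constP (ℚP.+-inverseʳ (ι (binary S))))) constP-0) ⟩
    0P +P t
      ≈⟨ R₁.+-identityˡ t ⟩
    t ∎
    where
    open SetoidReasoning R₁.setoid
    select : Bool → ℚ
    select b = ι (binary S) ℚ.+ (if b then ℚ.- ι (binary S) else 0ℚ)

  line⁰-separates : ∀ T → Nonempty T → ¬ (T ≡ S) → ¬ (ev₀ (substP line⁰ (phi0Sym T)) ≡ 0ℚ)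
  line⁰-separates T T≠∅ T≢S eq₀ = by-cases (Vec.lookup T s) (begin
    ι (binary T) ℚ.+ (if Vec.lookup T s then ℚ.- ι (binary S) else 0ℚ)  ≡⟨ sumOver-a⁰ T ⟨
    Σℚ.sumOver T a⁰                                                     ≡⟨ ev₀-substP-shiftedAt-phi0Sym s a⁰ t refl T ⟨
    ev₀ (substP line⁰ (phi0Sym T))                                      ≡⟨ eq₀ ⟩
    0ℚ                                                                  ∎)
    where
    open ≡.≡-Reasoning
    by-cases : ∀ b → ι (binary T) ℚ.+ (if b then ℚ.- ι (binary S) else 0ℚ) ≡ 0ℚ → ⊥
    by-cases true  eq = T≢S (binary-injective T S (ι-injective _ _ (x-y≡0⇒x≡y _ _ eq)))
    by-cases false eq = binary≢0 T T≠∅ (ι-injective _ 0 (≡.trans (≡.sym (ℚP.+-identityʳ _)) eq))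

module _ {n : ℕ} (S : Subset n) (s : Fin n) where

  private
    D : ℚ
    D = ι (2 ℕ.^ binary S)

    D≢0 : ¬ (D ≡ 0ℚ)
    D≢0 D≡0 with ℕP.m^n≡0⇒m≡0 2 (binary S) (ι-injective _ 0 D≡0)
    ... | ()

    instance
      D-nonZero : ℚ.NonZero D
      D-nonZero = ℚ.≢-nonZero D≢0

    x*1/D≡1⇒x≡D : ∀ x → x ℚ.* ℚ.1/ D ≡ 1ℚ → x ≡ D
    x*1/D≡1⇒x≡D x eq = begin
      x                     ≡⟨ ℚP.*-identityʳ x ⟨
      x ℚ.* 1ℚ              ≡⟨ cong (x ℚ.*_) (ℚP.*-inverseˡ D) ⟨
      x ℚ.* (ℚ.1/ D ℚ.* D)  ≡⟨ ℚP.*-assoc x (ℚ.1/ D) D ⟨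
      x ℚ.* ℚ.1/ D ℚ.* D    ≡⟨ cong (ℚ._* D) eq ⟩
      1ℚ ℚ.* D              ≡⟨ ℚP.*-identityˡ D ⟩
      D                     ∎
      where open ≡.≡-Reasoning

  -- u_j ↦ 2^(2^j), except u_s ↦ 2^(2^s) (1 + t) / 2^(binary S); this sends φ¹ T to
  -- 2^(binary T) (1 + t) / 2^(binary S) − 1 when s ∈ T, and to 2^(binary T) − 1 otherwise.
  a¹ : Fin n → ℚ
  a¹ j = ι (2 ℕ.^ 2 ℕ.^ toℕ j) ℚ.* (if does (j F.≟ s) then ℚ.1/ D else 1ℚ)

  line¹ : Fin n → Poly 1
  line¹ = scaledAt s a¹ (1P +P t)

  prodOver-a¹ : ∀ T → Πℚ.sumOver T a¹ ≡ ι (2 ℕ.^ binary T) ℚ.* (if Vec.lookup T s then ℚ.1/ D else 1ℚ)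
  prodOver-a¹ T = ≡.trans
    (Πℚ.sumOver-∙ T (λ j → ι (2 ℕ.^ 2 ℕ.^ toℕ j)) (λ j → if does (j F.≟ s) then ℚ.1/ D else 1ℚ))
    (cong₂ ℚ._*_ (≡.sym (≡.trans (cong ι (≡.sym (2^binary T))) (ι-prodOver T (λ j → 2 ℕ.^ 2 ℕ.^ toℕ j))))
                 (Πℚ.sumOver-δ T s (ℚ.1/ D)))

  line¹-through : Vec.lookup S s ≡ true → substP line¹ (phi1Sym S) ≋ t
  line¹-through s∈S = begin
    substP line¹ (phi1Sym S)
      ≈⟨ substP-scaledAt-phi1Sym s a¹ (1P +P t) S ⟩
    constP (Πℚ.sumOver S a¹) *P (if Vec.lookup S s then 1P +P t else 1P) -P 1P
      ≡⟨ cong₂ (λ a X → constP a *P X -P 1P) (≡.trans (prodOver-a¹ S) (cong select s∈S))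
                                             (cong (if_then 1P +P t else 1P) s∈S) ⟩
    constP (D ℚ.* ℚ.1/ D) *P (1P +P t) -P 1P
      ≡⟨ cong (λ a → constP a *P (1P +P t) -P 1P) (ℚP.*-inverseʳ D) ⟩
    1P *P (1P +P t) -P 1P
      ≈⟨ R₁.+-congʳ (R₁.trans (R₁.*-identityˡ _) (R₁.+-comm 1P t)) ⟩
    t +P 1P -P 1P
      ≈⟨ R₁.+-assoc t 1P (-P 1P) ⟩
    t +P (1P -P 1P)
      ≈⟨ R₁.+-congˡ (R₁.-‿inverseʳ 1P) ⟩
    t +P 0P
      ≈⟨ R₁.+-identityʳ t ⟩
    t ∎
    where
    open SetoidReasoning R₁.setoid
    select : Bool → ℚ
    select b = D ℚ.* (if b then ℚ.1/ D else 1ℚ)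

  line¹-separates : ∀ T → Nonempty T → ¬ (T ≡ S) → ¬ (ev₀ (substP line¹ (phi1Sym T)) ≡ 0ℚ)
  line¹-separates T T≠∅ T≢S eq₀ = by-cases (Vec.lookup T s) (x-y≡0⇒x≡y _ 1ℚ (begin
    ι (2 ℕ.^ binary T) ℚ.* (if Vec.lookup T s then ℚ.1/ D else 1ℚ) ℚ.- 1ℚ  ≡⟨ cong (ℚ._- 1ℚ) (prodOver-a¹ T) ⟨
    Πℚ.sumOver T a¹ ℚ.- 1ℚ                                                 ≡⟨ ev₀-substP-scaledAt-phi1Sym s a¹ (1P +P t) refl T ⟨
    ev₀ (substP line¹ (phi1Sym T))                                         ≡⟨ eq₀ ⟩
    0ℚ                                                                     ∎))
    where
    open ≡.≡-Reasoning
    by-cases : ∀ b → ι (2 ℕ.^ binary T) ℚ.* (if b then ℚ.1/ D else 1ℚ) ≡ 1ℚ → ⊥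
    by-cases true  eq = T≢S (binary-injective T S (2^-injective _ _ (ι-injective _ _ (x*1/D≡1⇒x≡D _ eq))))
    by-cases false eq = binary≢0 T T≠∅ (2^e≡1⇒e≡0 (ι-injective _ 1
      (≡.trans (≡.sym (ℚP.*-identityʳ _)) (≡.trans eq (≡.sym ι-1)))))

phi0Sym-separatingLines : SeparatingLines phi0Sym
phi0Sym-separatingLines S (s , s∈S) = line⁰ S s , line⁰-through S s (VecP.[]=⇒lookup s∈S) , line⁰-separates S s

phi1Sym-separatingLines : SeparatingLines phi1Sym
phi1Sym-separatingLines S (s , s∈S) = line¹ S s , line¹-through S s (VecP.[]=⇒lookup s∈S) , line¹-separates S s

mainTheorem2 : IsInjSymOperadMorphism phi0 comp0 unit0 × IsInjSymOperadMorphism phi1 comp1 unit1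
mainTheorem2 =
  record
    { valid          = extend-valid phi0Sym phi0Sym-nonvanishingPoint
    ; respects       = λ F G _ _ → extend-respects phi0Sym F G
    ; preserves-∘    = λ i F G _ _ → phi0-preserves-∘ i F G
    ; preserves-unit = phi0-preserves-unit
    ; equivariant    = λ π F _ → extend-equivariant π phi0Sym (substP-permuteVars-phi0Sym π) F
    ; injective      = extend-injective phi0Sym phi0Sym-separatingLines
    } ,
  record
    { valid          = extend-valid phi1Sym phi1Sym-nonvanishingPoint
    ; respects       = λ F G _ _ → extend-respects phi1Sym F G
    ; preserves-∘    = λ i F G _ _ → phi1-preserves-∘ i F G
    ; preserves-unit = phi1-preserves-unit
    ; equivariant    = λ π F _ → extend-equivariant π phi1Sym (substP-permuteVars-phi1Sym π) F
    ; injective      = extend-injective phi1Sym phi1Sym-separatingLines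
    }
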